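{- Let $u,v$ be reduced $n$-expressions, and let $\bar u v = w_0 \curvearrowright w_1 \curvearrowright \cdots \curvearrowright w_N = v'\bar{u'}$ be a reversing sequence ending in a word containing no subword $\bar\sigma_i\sigma_j$, where $u',v'$ are words in the letters $\sigma_i$. If none of the $N$ steps is of type III, then $\operatorname{dist}(uv', vu') = N$.
   Context: For $1\le i\le n-1$, $\sigma_i$ is the transposition exchanging $i$ and $i+1$. An $n$-expression is a word over $\{\sigma_1,\dots,\sigma_{n-1}\}$, representing the product of its letters read left to right; equivalent means same permutation; reduced means no shorter equivalent expression. Braid relations: (I) $\sigma_i\sigma_j\sigma_i=\sigma_j\sigma_i\sigma_j$ for $|i-j|=1$; (II) $\sigma_i\sigma_j=\sigma_j\sigma_i$ for $|i-j|\ge2$; for equivalent reduced expressions $x,y$, $\operatorname{dist}(x,y)$ is the minimal number of braid-relation applications transforming $x$ into $y$. Formal letters $\bar\sigma_i$; for a word $w$ in $\sigma_i,\bar\sigma_i$, $\bar w$ is obtained by reversing the letter order and swapping $\sigma_i\leftrightarrow\bar\sigma_i$. $w\curvearrowright w'$ means $w'$ is obtained from $w$ by replacing one subword $\bar\sigma_i\sigma_j$ by $\sigma_j\sigma_i\bar\sigma_j\bar\sigma_i$ if $|i-j|=1$ (type I step), by $\sigma_j\bar\sigma_i$ if $|i-j|\ge2$ (type II), or by the empty word if $i=j$ (type III). For reduced $u,v$, such a reversing from $\bar u v$ always terminates, and the resulting words $uv'$ and $vu'$ are equivalent reduced $n$-expressions. -}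

module Defs where

open import Data.Nat using (ℕ; zero; suc; _+_; _≤_; _<_; _≟_)
open import Relation.Nullary using (yes; no)
open import Data.List using (List; []; _∷_; _++_; length; map; reverse)
open import Data.List.Relation.Unary.All using (All)
open import Data.Product using (_×_; Σ; _,_)
open import Data.Sum using (_⊎_)
open import Relation.Binary.PropositionalEquality using (_≡_; _≢_)

-- The letter σ_i is represented by the natural number i.
-- Validity in S_n: 1 ≤ i and i < n  (i.e. 1 ≤ i ≤ n-1).
ValidLetter : ℕ → ℕ → Set
ValidLetter n i = (1 ≤ i) × (i < n)

Expr : ℕ → List ℕ → Set
Expr n w = All (ValidLetter n) w

transp : ℕ → ℕ → ℕ
transp i k with i ≟ k
... | yes _ = suc i
... | no _ with suc i ≟ k
...   | yes _ = i
...   | no _ = k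

-- the permutation represented by a word, letters read left to right
-- (product σ_{i1} σ_{i2} … ; as a map, apply the rightmost factor first)
perm : List ℕ → ℕ → ℕ
perm [] k = k
perm (i ∷ w) k = transp i (perm w k)

Equiv : List ℕ → List ℕ → Set
Equiv x y = ∀ k → perm x k ≡ perm y k

Reduced : ℕ → List ℕ → Set
Reduced n w = Expr n w × (∀ w' → Expr n w' → Equiv w w' → length w ≤ length w')

Adj : ℕ → ℕ → Set
Adj i j = (suc i ≡ j) ⊎ (suc j ≡ i)

Far : ℕ → ℕ → Set
Far i j = (2 + i ≤ j) ⊎ (2 + j ≤ i)

-- one application of a braid relation (in either direction; both relations
-- are symmetric as stated, by swapping i and j)
data BraidStep : List ℕ → List ℕ → Set where
  rel-I  : ∀ p s i j → Adj i j →
           BraidStep (p ++ i ∷ j ∷ i ∷ s) (p ++ j ∷ i ∷ j ∷ s)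
  rel-II : ∀ p s i j → Far i j →
           BraidStep (p ++ i ∷ j ∷ s) (p ++ j ∷ i ∷ s)

data BraidPath : ℕ → List ℕ → List ℕ → Set where
  done : ∀ x → BraidPath zero x x
  step : ∀ {k x y z} → BraidStep x y → BraidPath k y z → BraidPath (suc k) x z

Dist : List ℕ → List ℕ → ℕ → Set
Dist x y N = BraidPath N x y × (∀ k → BraidPath k x y → N ≤ k)

data SLetter : Set where
  pos : ℕ → SLetter
  neg : ℕ → SLetter

SWord : Set
SWord = List SLetter

barL : SLetter → SLetter
barL (pos i) = neg i
barL (neg i) = pos i

bar : SWord → SWord
bar w = reverse (map barL w)

emb : List ℕ → SWord
emb = map pos

data RevType : Set where
  typeI typeII typeIII : RevType

data RevStep : RevType → SWord → SWord → Set where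
  revI   : ∀ p s i j → Adj i j →
           RevStep typeI (p ++ neg i ∷ pos j ∷ s) (p ++ pos j ∷ pos i ∷ neg j ∷ neg i ∷ s)
  revII  : ∀ p s i j → Far i j →
           RevStep typeII (p ++ neg i ∷ pos j ∷ s) (p ++ pos j ∷ neg i ∷ s)
  revIII : ∀ p s i →
           RevStep typeIII (p ++ neg i ∷ pos i ∷ s) (p ++ s)

data RevSeq : List RevType → SWord → SWord → Set where
  rdone : ∀ w → RevSeq [] w w
  rstep : ∀ {t ts x y z} → RevStep t x y → RevSeq ts y z → RevSeq (t ∷ ts) x z

-- Without type III steps, reversing is strongly confluent: a
-- step available in a word that reverses to a normal form can always be taken first
-- (anyStepFirst).  So the reversing of ū v splits into a first cell σ̄_a σ_b ↦ β ᾱ, which is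
-- one braid relation a β = b α, and three shorter reversings; strong induction on N turns this
-- grid into a braid path of length N from u v′ to v u′ (upperBound).
--
-- A word is read as a strand diagram (Strands): each letter crosses two strands
-- and is labelled by that pair (Labels); a reduced word crosses every pair at most once.  For a
-- list Lx of labels, the potential Λ of a signed label list counts, with signs, the ordered
-- pairs of crossings that form an item (two disjoint or chained pairs of strands, Blocks) and
-- appear in the order of Lx (Potential, Orientation).  With Lx the crossings of u v′, we follow
-- the labels of u w v̄ along the reversing (LowerBound.Sandwich): they stay nested (Nesting),
-- which fixes the relative order of the crossings involved in each step, so every step raises
-- Λ by exactly one, from Λ(u ū v v̄) = 0 to Λ(u v′ ū′ v̄) = N.  A braid relation changes
-- Λ(x ȳ) by at most one and Λ(y ȳ) = 0 (LowerBound.Relative), so every braid path from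
-- x = u v′ to y = v u′ has length at least N.
module Submission where

open import Defs
open import Data.Nat using (ℕ)
open import Data.List using (List; length; _++_)
open import Data.List.Relation.Unary.All using (All)
open import Data.List.Relation.Unary.Unique.Propositional using (Unique)
open import Data.Product using (_,_)
open import Relation.Binary.PropositionalEquality using (_≢_; refl; cong; subst₂)

module Reversing where

  open import Data.Nat using (ℕ; zero; suc; _+_; _<_; s≤s; _≟_; <-cmp)
  open import Data.Nat.Properties
    using (≤∧≢⇒<; ≤-trans; m≤n+m; n≤1+n; 1+n≰n; ≤-reflexive; suc-injective; m≤m+n)
  open import Data.Nat.Induction using (<-rec)
  open import Data.Nat.Tactic.RingSolver using (solve-∀)
  open import Data.List using (List; []; _∷_; _++_; length; map; reverse)
  open import Data.List.Properties
    using (++-assoc; ++-identityʳ; ∷-injective; unfold-reverse; reverse-involutive; reverse-injective;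
           reverse-map; map-∘; map-injective; map-++)
  open import Data.List.Relation.Unary.All using (All; []; _∷_)
  open import Data.Product using (_×_; Σ; _,_; proj₁; proj₂)
  open import Data.Sum using (_⊎_; inj₁; inj₂)
  open import Data.Empty using (⊥; ⊥-elim)
  open import Relation.Nullary using (yes; no)
  open import Relation.Binary using (tri<; tri≈; tri>)
  open import Relation.Binary.PropositionalEquality

  NoIII : List RevType → Set
  NoIII = All (λ t → t ≢ typeIII)

  negs : List ℕ → SWord
  negs [] = []
  negs (a ∷ u) = negs u ++ neg a ∷ []

  bar-emb : ∀ u → bar (emb u) ≡ negs u
  bar-emb [] = refl
  bar-emb (a ∷ u) = trans (unfold-reverse (neg a) (map barL (emb u))) (cong (_++ neg a ∷ []) (bar-emb u))

  negs-++ : ∀ a b → negs (a ++ b) ≡ negs b ++ negs a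
  negs-++ [] b = sym (++-identityʳ (negs b))
  negs-++ (x ∷ a) b = trans (cong (_++ neg x ∷ []) (negs-++ a b)) (++-assoc (negs b) (negs a) _)

  negs-reverse : ∀ u → negs u ≡ map neg (reverse u)
  negs-reverse u = begin
    negs u                 ≡⟨ sym (bar-emb u) ⟩
    reverse (map barL (map pos u)) ≡⟨ cong reverse (sym (map-∘ u)) ⟩
    reverse (map neg u)    ≡⟨ sym (reverse-map neg u) ⟩
    map neg (reverse u)    ∎
    where open ≡-Reasoning

  -- Normal words: words containing no subword σ̄_i σ_j, i.e. words where no reversing step applies.
  data Normal : SWord → Set where
    normal[]  : Normal []
    normal1   : ∀ x → Normal (x ∷ [])
    normalPos : ∀ {i y w} → Normal (y ∷ w) → Normal (pos i ∷ y ∷ w)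
    normalNeg : ∀ {i j w} → Normal (neg j ∷ w) → Normal (neg i ∷ neg j ∷ w)

  normal-tail : ∀ {x w} → Normal (x ∷ w) → Normal w
  normal-tail (normal1 x) = normal[]
  normal-tail (normalPos h) = h
  normal-tail (normalNeg h) = h

  normal-noRedex : ∀ p s i j → Normal (p ++ neg i ∷ pos j ∷ s) → ⊥
  normal-noRedex [] s i j ()
  normal-noRedex (x ∷ p) s i j h = normal-noRedex p s i j (normal-tail h)

  -- The normal words are exactly the words v ū with u, v positive; we first work with the
  -- form  emb v ++ map neg r  (r = reverse u), then translate to v ū.
  normal-negative : ∀ r → Normal (map neg r)
  normal-negative [] = normal[]
  normal-negative (a ∷ []) = normal1 _
  normal-negative (a ∷ b ∷ r) = normalNeg (normal-negative (b ∷ r))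

  normal-canonical′ : ∀ v r → Normal (emb v ++ map neg r)
  normal-canonical′ [] r = normal-negative r
  normal-canonical′ (a ∷ []) [] = normal1 _
  normal-canonical′ (a ∷ []) (b ∷ r) = normalPos (normal-negative (b ∷ r))
  normal-canonical′ (a ∷ b ∷ v) r = normalPos (normal-canonical′ (b ∷ v) r)

  normal-canonical : ∀ v u → Normal (emb v ++ negs u)
  normal-canonical v u = subst (λ z → Normal (emb v ++ z)) (sym (negs-reverse u)) (normal-canonical′ v (reverse u))

  negative-after-neg : ∀ j x → Normal (neg j ∷ x) → Σ (List ℕ) λ r → x ≡ map neg r
  negative-after-neg j [] h = [] , refl
  negative-after-neg j (pos k ∷ x) ()
  negative-after-neg j (neg k ∷ x) (normalNeg h) with negative-after-neg k x h
  ... | r , e = k ∷ r , cong (neg k ∷_) e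

  normal-split′ : ∀ x → Normal x → Σ (List ℕ) λ v → Σ (List ℕ) λ r → x ≡ emb v ++ map neg r
  normal-split′ [] h = [] , [] , refl
  normal-split′ (pos i ∷ x) h with normal-split′ x (normal-tail h)
  ... | v , r , e = i ∷ v , r , cong (pos i ∷_) e
  normal-split′ (neg i ∷ x) h with negative-after-neg i x h
  ... | r , e = [] , i ∷ r , cong (neg i ∷_) e

  normal-split : ∀ x → Normal x → Σ (List ℕ) λ v → Σ (List ℕ) λ u → x ≡ emb v ++ negs u
  normal-split x h with normal-split′ x h
  ... | v , r , e = v , reverse r , trans e (cong (emb v ++_) (sym (begin
    negs (reverse r)              ≡⟨ negs-reverse (reverse r) ⟩
    map neg (reverse (reverse r)) ≡⟨ cong (map neg) (reverse-involutive r) ⟩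
    map neg r                     ∎)))
    where open ≡-Reasoning

  canonical-injective′ : ∀ a r c q → emb a ++ map neg r ≡ emb c ++ map neg q → a ≡ c × r ≡ q
  canonical-injective′ [] r [] q e = refl , map-injective (λ { refl → refl }) e
  canonical-injective′ [] [] (x ∷ c) q ()
  canonical-injective′ [] (_ ∷ r) (x ∷ c) q ()
  canonical-injective′ (x ∷ a) r [] [] ()
  canonical-injective′ (x ∷ a) r [] (_ ∷ q) ()
  canonical-injective′ (x ∷ a) r (y ∷ c) q e with ∷-injective e
  ... | refl , e′ with canonical-injective′ a r c q e′
  ...   | refl , r≡q = refl , r≡q

  canonical-injective : ∀ a r c q → emb a ++ negs r ≡ emb c ++ negs q → a ≡ c × r ≡ q
  canonical-injective a r c q e
    with canonical-injective′ a (reverse r) c (reverse q)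
           (trans (cong (emb a ++_) (sym (negs-reverse r))) (trans e (cong (emb c ++_) (negs-reverse q))))
  ... | a≡c , rr≡rq = a≡c , reverse-injective rr≡rq

  result : RevType → ℕ → ℕ → SWord
  result typeI i j = pos j ∷ pos i ∷ neg j ∷ neg i ∷ []
  result typeII i j = pos j ∷ neg i ∷ []
  result typeIII i j = []

  Allowed : RevType → ℕ → ℕ → Set
  Allowed typeI i j = Adj i j
  Allowed typeII i j = Far i j
  Allowed typeIII i j = i ≡ j

  revStep : ∀ t {i j} → Allowed t i j → ∀ p s → RevStep t (p ++ neg i ∷ pos j ∷ s) (p ++ result t i j ++ s)
  revStep typeI {i} {j} h p s = revI p s i j h
  revStep typeII {i} {j} h p s = revII p s i j h
  revStep typeIII {i} refl p s = revIII p s i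

  record Redex (t : RevType) (x y : SWord) : Set where
    constructor redex
    field
      prefix suffix : SWord
      left right : ℕ
      allowed : Allowed t left right
      source : x ≡ prefix ++ neg left ∷ pos right ∷ suffix
      target : y ≡ prefix ++ result t left right ++ suffix

  redexOf : ∀ {t x y} → RevStep t x y → Redex t x y
  redexOf (revI p s i j h) = redex p s i j h refl refl
  redexOf (revII p s i j h) = redex p s i j h refl refl
  redexOf (revIII p s i) = redex p s i i refl refl refl

  adj-not-far : ∀ {i j} → Adj i j → Far i j → ⊥
  adj-not-far (inj₁ refl) (inj₁ (s≤s h)) = 1+n≰n h
  adj-not-far {i} (inj₁ refl) (inj₂ h) = 1+n≰n (≤-trans (m≤n+m (suc i) 2) h)
  adj-not-far {j = j} (inj₂ refl) (inj₁ h) = 1+n≰n (≤-trans (m≤n+m (suc j) 2) h)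
  adj-not-far (inj₂ refl) (inj₂ (s≤s h)) = 1+n≰n h

  adj-irrefl : ∀ {i} → Adj i i → ⊥
  adj-irrefl (inj₁ e) = 1+n≰n (≤-reflexive e)
  adj-irrefl (inj₂ e) = 1+n≰n (≤-reflexive e)

  far-irrefl : ∀ {i} → Far i i → ⊥
  far-irrefl {i} (inj₁ h) = 1+n≰n (≤-trans (n≤1+n (suc i)) h)
  far-irrefl {i} (inj₂ h) = 1+n≰n (≤-trans (n≤1+n (suc i)) h)

  allowed-unique : ∀ t t′ {i j} → Allowed t i j → Allowed t′ i j → t ≡ t′
  allowed-unique typeI typeI a b = refl
  allowed-unique typeI typeII a b = ⊥-elim (adj-not-far a b)
  allowed-unique typeI typeIII a refl = ⊥-elim (adj-irrefl a)
  allowed-unique typeII typeI a b = ⊥-elim (adj-not-far b a)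
  allowed-unique typeII typeII a b = refl
  allowed-unique typeII typeIII a refl = ⊥-elim (far-irrefl a)
  allowed-unique typeIII typeI refl b = ⊥-elim (adj-irrefl b)
  allowed-unique typeIII typeII refl b = ⊥-elim (far-irrefl b)
  allowed-unique typeIII typeIII a b = refl

  classify : ∀ i j → Σ RevType λ t → Allowed t i j
  classify i j with <-cmp i j
  ... | tri≈ _ e _ = typeIII , e
  ... | tri< i<j _ _ with suc i ≟ j
  ...   | yes e = typeI , inj₁ e
  ...   | no ne = typeII , inj₁ (≤∧≢⇒< i<j ne)
  classify i j | tri> _ _ j<i with suc j ≟ i
  ...   | yes e = typeI , inj₂ e
  ...   | no ne = typeII , inj₂ (≤∧≢⇒< j<i ne)

  data Overlap (p₁ s₁ : SWord) (i₁ j₁ : ℕ) (p₂ s₂ : SWord) (i₂ j₂ : ℕ) : Set where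
    same    : p₁ ≡ p₂ → i₁ ≡ i₂ → j₁ ≡ j₂ → s₁ ≡ s₂ → Overlap p₁ s₁ i₁ j₁ p₂ s₂ i₂ j₂
    leftOf  : ∀ m → p₂ ≡ p₁ ++ neg i₁ ∷ pos j₁ ∷ m → s₁ ≡ m ++ neg i₂ ∷ pos j₂ ∷ s₂ →
              Overlap p₁ s₁ i₁ j₁ p₂ s₂ i₂ j₂
    rightOf : ∀ m → p₁ ≡ p₂ ++ neg i₂ ∷ pos j₂ ∷ m → s₂ ≡ m ++ neg i₁ ∷ pos j₁ ∷ s₁ →
              Overlap p₁ s₁ i₁ j₁ p₂ s₂ i₂ j₂

  redexOverlap : ∀ p₁ s₁ i₁ j₁ p₂ s₂ i₂ j₂ →
    p₁ ++ neg i₁ ∷ pos j₁ ∷ s₁ ≡ p₂ ++ neg i₂ ∷ pos j₂ ∷ s₂ → Overlap p₁ s₁ i₁ j₁ p₂ s₂ i₂ j₂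
  redexOverlap [] s₁ i₁ j₁ [] s₂ i₂ j₂ refl = same refl refl refl refl
  redexOverlap [] s₁ i₁ j₁ (x ∷ []) s₂ i₂ j₂ ()
  redexOverlap [] s₁ i₁ j₁ (x ∷ y ∷ p₂) s₂ i₂ j₂ refl = leftOf p₂ refl refl
  redexOverlap (x ∷ []) s₁ i₁ j₁ [] s₂ i₂ j₂ ()
  redexOverlap (x ∷ y ∷ p₁) s₁ i₁ j₁ [] s₂ i₂ j₂ refl = rightOf p₁ refl refl
  redexOverlap (x ∷ p₁) s₁ i₁ j₁ (y ∷ p₂) s₂ i₂ j₂ e with ∷-injective e
  ... | refl , e′ with redexOverlap p₁ s₁ i₁ j₁ p₂ s₂ i₂ j₂ e′
  ...   | same a b c d = same (cong (x ∷_) a) b c d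
  ...   | leftOf m a b = leftOf m (cong (x ∷_) a) b
  ...   | rightOf m a b = rightOf m (cong (x ∷_) a) b

  reassoc : ∀ (p A m X : SWord) → (p ++ A ++ m) ++ X ≡ p ++ A ++ m ++ X
  reassoc p A m X = trans (++-assoc p (A ++ m) X) (cong (p ++_) (++-assoc A m X))

  record Resumes (ts : List RevType) (w z : SWord) : Set where
    constructor resumes
    field
      rest : List RevType
      restSeq : RevSeq rest w z
      restNoIII : NoIII rest
      shorter : length ts ≡ suc (length rest)

  -- Key confluence property: if w reverses to a normal word z without type III steps, then
  -- any step w ↷ w′ is not of type III, and w′ reverses to z with one step fewer.  (Disjoint
  -- redexes commute; an identical redex gives an identical step.)
  anyStepFirst : ∀ {ts w z t w′} → RevSeq ts w z → NoIII ts → Normal z → RevStep t w w′ →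
    t ≢ typeIII × Resumes ts w′ z
  anyStepFirst (rdone w) _ nz st with redexOf st
  ... | redex p s i j _ refl _ = ⊥-elim (normal-noRedex p s i j nz)
  anyStepFirst {t = t} (rstep {t = t₁} st₁ rest) (n₁ ∷ ns) nz st with redexOf st₁ | redexOf st
  ... | redex p₁ s₁ i₁ j₁ ok₁ e₁ f₁ | redex p₂ s₂ i₂ j₂ ok₂ e₂ f₂
    with redexOverlap p₁ s₁ i₁ j₁ p₂ s₂ i₂ j₂ (trans (sym e₁) e₂)
  ... | same refl refl refl refl with allowed-unique t₁ t ok₁ ok₂
  ...   | refl = n₁ , resumes _ (subst (λ q → RevSeq _ q _) (trans f₁ (sym f₂)) rest) ns refl
  anyStepFirst {t = t} (rstep {t = t₁} st₁ rest) (n₁ ∷ ns) nz st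
      | redex p₁ s₁ i₁ j₁ ok₁ e₁ f₁ | redex p₂ s₂ i₂ j₂ ok₂ e₂ f₂ | leftOf m refl refl
    with anyStepFirst rest ns nz
           (subst₂ (RevStep t) (trans (reassoc p₁ _ m _) (sym f₁)) refl (revStep t ok₂ (p₁ ++ result t₁ i₁ j₁ ++ m) s₂))
  ... | nt , resumes ts′ sq′ ns′ len =
    nt , resumes (t₁ ∷ ts′)
           (rstep (subst₂ (RevStep t₁) (trans (sym (reassoc p₁ _ m _)) (sym f₂)) (sym (reassoc p₁ _ m _))
                    (revStep t₁ ok₁ p₁ (m ++ result t i₂ j₂ ++ s₂))) sq′)
           (n₁ ∷ ns′) (cong suc len)
  anyStepFirst {t = t} (rstep {t = t₁} st₁ rest) (n₁ ∷ ns) nz st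
      | redex p₁ s₁ i₁ j₁ ok₁ e₁ f₁ | redex p₂ s₂ i₂ j₂ ok₂ e₂ f₂ | rightOf m refl refl
    with anyStepFirst rest ns nz
           (subst₂ (RevStep t) (trans (sym (reassoc p₂ _ m _)) (sym f₁)) refl (revStep t ok₂ p₂ (m ++ result t₁ i₁ j₁ ++ s₁)))
  ... | nt , resumes ts′ sq′ ns′ len =
    nt , resumes (t₁ ∷ ts′)
           (rstep (subst₂ (RevStep t₁) (trans (reassoc p₂ _ m _) (sym f₂)) (reassoc p₂ _ m _)
                    (revStep t₁ ok₁ (p₂ ++ result t i₂ j₂ ++ m) s₁)) sq′)
           (n₁ ∷ ns′) (cong suc len)

  stepInContext : ∀ {t x y} → RevStep t x y → ∀ p s → RevStep t (p ++ x ++ s) (p ++ y ++ s)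
  stepInContext {t} st p s with redexOf st
  ... | redex q r i j ok refl refl =
    subst₂ (RevStep t)
      (trans (++-assoc p q _) (cong (p ++_) (sym (++-assoc q _ s))))
      (trans (++-assoc p q _) (cong (p ++_) (trans (cong (q ++_) (sym (++-assoc (result t i j) r s))) (sym (++-assoc q _ s)))))
      (revStep t ok (p ++ q) (r ++ s))

  stepUnder : ∀ {t x y} c → RevStep t x y → RevStep t (c ∷ x) (c ∷ y)
  stepUnder c st = subst₂ (RevStep _) (cong (c ∷_) (++-identityʳ _)) (cong (c ∷_) (++-identityʳ _)) (stepInContext st (c ∷ []) [])

  progress : ∀ x → Normal x ⊎ (Σ RevType λ t → Σ SWord λ x′ → RevStep t x x′)
  progress [] = inj₁ normal[]
  progress (y ∷ []) = inj₁ (normal1 y)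
  progress (pos i ∷ y ∷ w) with progress (y ∷ w)
  ... | inj₁ h = inj₁ (normalPos h)
  ... | inj₂ (t , x′ , st) = inj₂ (t , pos i ∷ x′ , stepUnder (pos i) st)
  progress (neg i ∷ pos j ∷ w) with classify i j
  ... | t , ok = inj₂ (t , _ , revStep t ok [] w)
  progress (neg i ∷ neg j ∷ w) with progress (neg j ∷ w)
  ... | inj₁ h = inj₁ (normalNeg h)
  ... | inj₂ (t , x′ , st) = inj₂ (t , neg i ∷ x′ , stepUnder (neg i) st)

  normal-stuck : ∀ {ts w z} → Normal w → RevSeq ts w z → ts ≡ [] × w ≡ z
  normal-stuck nw (rdone _) = refl , refl
  normal-stuck nw (rstep st _) with redexOf st
  ... | redex p s i j _ refl _ = ⊥-elim (normal-noRedex p s i j nw)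

  canonical-stuck : ∀ {ts} a b v u → RevSeq ts (emb a ++ negs b) (emb v ++ negs u) → ts ≡ [] × a ≡ v × b ≡ u
  canonical-stuck a b v u sq with normal-stuck (normal-canonical a b) sq
  ... | refl , e = refl , canonical-injective a b v u e

  -- The proof moves the steps inside x
  -- to the front one at a time (anyStepFirst), by induction on the length N.
  record FactorFirst (ts : List RevType) (p x s z : SWord) : Set where
    constructor factorFirst
    field
      v′ u′ : List ℕ
      inner outer : List RevType
      innerSeq : RevSeq inner x (emb v′ ++ negs u′)
      innerNoIII : NoIII inner
      outerSeq : RevSeq outer (p ++ (emb v′ ++ negs u′) ++ s) z
      outerNoIII : NoIII outer
      lengths : length ts ≡ length inner + length outer

  reverseFactorFirst : ∀ N {ts z} p x s → length ts ≡ N → RevSeq ts (p ++ x ++ s) z → NoIII ts → Normal z →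
    FactorFirst ts p x s z
  reverseFactorFirst N p x s len sq ns nz with progress x
  ... | inj₁ nx with normal-split x nx
  ...   | v′ , u′ , refl = factorFirst v′ u′ [] _ (rdone _) [] sq ns refl
  reverseFactorFirst zero p x s len sq ns nz | inj₂ (t , x′ , st)
    with anyStepFirst sq ns nz (stepInContext st p s)
  ... | _ , resumes _ _ _ len′ with trans (sym len) len′
  ... | ()
  reverseFactorFirst (suc N) p x s len sq ns nz | inj₂ (t , x′ , st)
    with anyStepFirst sq ns nz (stepInContext st p s)
  ... | nt , resumes ts′ sq′ ns′ len′
    with reverseFactorFirst N p x′ s (suc-injective (trans (sym len′) len)) sq′ ns′ nz
  ... | factorFirst v′ u′ inner outer sq₁ n₁ sq₂ n₂ lens =
    factorFirst v′ u′ (t ∷ inner) outer (rstep st sq₁) (nt ∷ n₁) sq₂ n₂ (trans len′ (cong suc lens))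

  braid-++ : ∀ {k m x y z} → BraidPath k x y → BraidPath m y z → BraidPath (k + m) x z
  braid-++ (done _) b = b
  braid-++ (step s b₁) b = step s (braid-++ b₁ b)

  braid-retype : ∀ {k x x′ y y′} → x ≡ x′ → y ≡ y′ → BraidPath k x y → BraidPath k x′ y′
  braid-retype refl refl b = b

  braidStepInContext : ∀ {x y} → BraidStep x y → ∀ p s → BraidStep (p ++ x ++ s) (p ++ y ++ s)
  braidStepInContext (rel-I q r i j h) p s = subst₂ BraidStep
    (trans (++-assoc p q _) (cong (p ++_) (sym (++-assoc q _ s))))
    (trans (++-assoc p q _) (cong (p ++_) (sym (++-assoc q _ s))))
    (rel-I (p ++ q) (r ++ s) i j h)
  braidStepInContext (rel-II q r i j h) p s = subst₂ BraidStep
    (trans (++-assoc p q _) (cong (p ++_) (sym (++-assoc q _ s))))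
    (trans (++-assoc p q _) (cong (p ++_) (sym (++-assoc q _ s))))
    (rel-II (p ++ q) (r ++ s) i j h)

  braidInContext : ∀ {k x y} → BraidPath k x y → ∀ p s → BraidPath k (p ++ x ++ s) (p ++ y ++ s)
  braidInContext (done _) p s = done _
  braidInContext (step st b) p s = step (braidStepInContext st p s) (braidInContext b p s)

  cell : ∀ t a b → Allowed t a b → t ≢ typeIII →
    Σ (List ℕ) λ β → Σ (List ℕ) λ α → (result t a b ≡ emb β ++ negs α) × BraidPath 1 (a ∷ β) (b ∷ α)
  cell typeI a b ok _ = b ∷ a ∷ [] , a ∷ b ∷ [] , refl , step (rel-I [] [] a b ok) (done _)
  cell typeII a b ok _ = b ∷ [] , a ∷ [] , refl , step (rel-II [] [] a b ok) (done _)
  cell typeIII a b ok nt = ⊥-elim (nt refl)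

  grid-start : ∀ u₂ β α v₂ → negs u₂ ++ (emb β ++ negs α) ++ emb v₂ ≡ [] ++ (negs u₂ ++ emb β) ++ negs α ++ emb v₂
  grid-start u₂ β α v₂ = trans (cong (negs u₂ ++_) (++-assoc (emb β) _ _)) (sym (++-assoc (negs u₂) _ _))

  regroup : ∀ (B U V A : SWord) → (B ++ U) ++ (V ++ A) ++ [] ≡ B ++ (U ++ V) ++ A
  regroup B U V A rewrite ++-identityʳ (V ++ A) | ++-assoc B U (V ++ A) | ++-assoc U V A = refl

  grid-end : ∀ b v u a → emb b ++ (emb v ++ negs u) ++ negs a ≡ emb (b ++ v) ++ negs (a ++ u)
  grid-end b v u a = trans (cong (emb b ++_) (++-assoc (emb v) _ _))
    (trans (sym (++-assoc (emb b) (emb v) _)) (cong₂ _++_ (sym (map-++ pos b v)) (sym (negs-++ a u))))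

  grid-count : ∀ {N R₁ R₂} a b c → N ≡ a + R₁ → R₁ ≡ b + R₂ → R₂ ≡ c + 0 → N ≡ a + b + c
  grid-count a b c refl refl refl = lemma a b c
    where
    lemma : ∀ a b c → a + (b + (c + 0)) ≡ a + b + c
    lemma = solve-∀

  record Grid (u₂ β α v₂ v′ u′ : List ℕ) (ts : List RevType) : Set where
    constructor grid
    field
      β′ u₂″ v₂″ α″ v₃ u₃ : List ℕ
      ts₁ ts₂ ts₃ : List RevType
      seq₁ : RevSeq ts₁ (negs u₂ ++ emb β) (emb β′ ++ negs u₂″)
      seq₂ : RevSeq ts₂ (negs α ++ emb v₂) (emb v₂″ ++ negs α″)
      seq₃ : RevSeq ts₃ (negs u₂″ ++ emb v₂″) (emb v₃ ++ negs u₃)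
      admissible₁ : NoIII ts₁
      admissible₂ : NoIII ts₂
      admissible₃ : NoIII ts₃
      v′-split : v′ ≡ β′ ++ v₃
      u′-split : u′ ≡ α″ ++ u₃
      count : length ts ≡ length ts₁ + length ts₂ + length ts₃

  reverseGrid : ∀ u₂ β α v₂ v′ u′ {ts} → RevSeq ts (negs u₂ ++ (emb β ++ negs α) ++ emb v₂) (emb v′ ++ negs u′) →
    NoIII ts → Grid u₂ β α v₂ v′ u′ ts
  reverseGrid u₂ β α v₂ v′ u′ {ts} sq ns
    with reverseFactorFirst _ [] (negs u₂ ++ emb β) (negs α ++ emb v₂) refl
           (subst (λ q → RevSeq ts q _) (grid-start u₂ β α v₂) sq) ns (normal-canonical v′ u′)
  ... | factorFirst β′ u₂″ ts₁ r₁ sq₁ ns₁ sqr₁ nr₁ len₁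
    with reverseFactorFirst _ (emb β′ ++ negs u₂″) (negs α ++ emb v₂) [] refl
           (subst (λ q → RevSeq r₁ q _) (cong ((emb β′ ++ negs u₂″) ++_) (sym (++-identityʳ _))) sqr₁)
           nr₁ (normal-canonical v′ u′)
  ... | factorFirst v₂″ α″ ts₂ r₂ sq₂ ns₂ sqr₂ nr₂ len₂
    with reverseFactorFirst _ (emb β′) (negs u₂″ ++ emb v₂″) (negs α″) refl
           (subst (λ q → RevSeq r₂ q _) (regroup (emb β′) (negs u₂″) (emb v₂″) (negs α″)) sqr₂)
           nr₂ (normal-canonical v′ u′)
  ... | factorFirst v₃ u₃ ts₃ r₃ sq₃ ns₃ sqr₃ nr₃ len₃
    with canonical-stuck (β′ ++ v₃) (α″ ++ u₃) v′ u′ (subst (λ q → RevSeq r₃ q _) (grid-end β′ v₃ u₃ α″) sqr₃)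
  ... | refl , refl , refl =
    grid β′ u₂″ v₂″ α″ v₃ u₃ ts₁ ts₂ ts₃ sq₁ sq₂ sq₃ ns₁ ns₂ ns₃ refl refl
      (grid-count (length ts₁) (length ts₂) (length ts₃) len₁ len₂ len₃)

  -- The upper bound of Proposition 2.7, by strong induction on N.  For u = a u₂ and v = b v₂,
  -- the first step at σ̄_a σ_b yields ū₂ β ᾱ v₂ (cell), which reverses as a grid.
  UpperBound : ℕ → Set
  UpperBound N = ∀ u v v′ u′ ts → length ts ≡ N → RevSeq ts (negs u ++ emb v) (emb v′ ++ negs u′) → NoIII ts →
    BraidPath N (u ++ v′) (v ++ u′)

  summands< : ∀ {N} a b c → N ≡ suc (a + b + c) → a < N × b < N × c < N
  summands< a b c refl =
    s≤s (≤-trans (m≤m+n a b) (m≤m+n (a + b) c)) , s≤s (≤-trans (m≤n+m b a) (m≤m+n (a + b) c)) , s≤s (m≤n+m c (a + b))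

  grid-length : ∀ a b c → a + (c + (1 + b)) ≡ suc (a + b + c)
  grid-length = solve-∀

  -- Given the cell a β = b α and the grid, the induction hypotheses for the three parts of the
  -- grid and the cell give  a u₂ β′ v₃ → a β u₂″ v₃ → a β v₂″ u₃ → b α v₂″ u₃ → b v₂ α″ u₃.
  gridPath : ∀ {N a b u₂ v₂ β α v′ u′ ts′} → (∀ {M} → M < N → UpperBound M) → N ≡ suc (length ts′) →
    BraidPath 1 (a ∷ β) (b ∷ α) → Grid u₂ β α v₂ v′ u′ ts′ → BraidPath N (a ∷ u₂ ++ v′) (b ∷ v₂ ++ u′)
  gridPath {N} {a} {b} {u₂} {v₂} {β} {α} ih len cellPath
    (grid β′ u₂″ v₂″ α″ v₃ u₃ ts₁ ts₂ ts₃ sq₁ sq₂ sq₃ ns₁ ns₂ ns₃ refl refl count) =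
    subst (λ k → BraidPath k _ _) (trans (grid-length k₁ k₂ k₃) (sym total)) (braid-++ seg₁ (braid-++ seg₂ (braid-++ seg₃ seg₄)))
    where
    k₁ k₂ k₃ : ℕ
    k₁ = length ts₁
    k₂ = length ts₂
    k₃ = length ts₃
    total : N ≡ suc (k₁ + k₂ + k₃)
    total = trans len (cong suc count)
    bounds : k₁ < N × k₂ < N × k₃ < N
    bounds = summands< k₁ k₂ k₃ total
    seg₁ : BraidPath k₁ (a ∷ u₂ ++ β′ ++ v₃) (a ∷ β ++ u₂″ ++ v₃)
    seg₁ = braid-retype (cong (a ∷_) (++-assoc u₂ β′ v₃)) (cong (a ∷_) (++-assoc β u₂″ v₃))
             (braidInContext (ih (proj₁ bounds) u₂ β β′ u₂″ ts₁ refl sq₁ ns₁) (a ∷ []) v₃)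
    seg₂ : BraidPath k₃ (a ∷ β ++ u₂″ ++ v₃) (a ∷ β ++ v₂″ ++ u₃)
    seg₂ = braid-retype (cong ((a ∷ β) ++_) (++-identityʳ _)) (cong ((a ∷ β) ++_) (++-identityʳ _))
             (braidInContext (ih (proj₂ (proj₂ bounds)) u₂″ v₂″ v₃ u₃ ts₃ refl sq₃ ns₃) (a ∷ β) [])
    seg₃ : BraidPath 1 (a ∷ β ++ v₂″ ++ u₃) (b ∷ α ++ v₂″ ++ u₃)
    seg₃ = braidInContext cellPath [] (v₂″ ++ u₃)
    seg₄ : BraidPath k₂ (b ∷ α ++ v₂″ ++ u₃) (b ∷ v₂ ++ α″ ++ u₃)
    seg₄ = braid-retype (cong (b ∷_) (++-assoc α v₂″ u₃)) (cong (b ∷_) (++-assoc v₂ α″ u₃))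
             (braidInContext (ih (proj₁ (proj₂ bounds)) α v₂ v₂″ α″ ts₂ refl sq₂ ns₂) (b ∷ []) u₃)

  upperBound : ∀ N → UpperBound N
  upperBound = <-rec UpperBound go
    where
    go : ∀ N → (∀ {M} → M < N → UpperBound M) → UpperBound N
    go N ih [] v v′ u′ ts refl sq ns
      with canonical-stuck v [] v′ u′ (subst (λ q → RevSeq ts q _) (sym (++-identityʳ (emb v))) sq)
    ... | refl , refl , refl = braid-retype refl (sym (++-identityʳ v)) (done v)
    go N ih (a ∷ u₂) [] v′ u′ ts refl sq ns
      with canonical-stuck [] (a ∷ u₂) v′ u′ (subst (λ q → RevSeq ts q _) (++-identityʳ (negs (a ∷ u₂))) sq)
    ... | refl , refl , refl = braid-retype (sym (++-identityʳ (a ∷ u₂))) refl (done (a ∷ u₂))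
    go N ih (a ∷ u₂) (b ∷ v₂) v′ u′ ts refl sq ns with classify a b
    ... | t , ok
      with anyStepFirst sq ns (normal-canonical v′ u′)
             (subst₂ (RevStep t) (sym (++-assoc (negs u₂) (neg a ∷ []) _)) refl (revStep t ok (negs u₂) (emb v₂)))
    ... | nt , resumes ts′ sq′ ns′ len′ with cell t a b ok nt
    ... | β , α , res≡ , cellPath =
      gridPath ih len′ cellPath (reverseGrid u₂ β α v₂ v′ u′ (subst (λ q → RevSeq ts′ (negs u₂ ++ q ++ emb v₂) _) res≡ sq′) ns′)

module Transpositions where

  open import Data.Nat using (ℕ; suc; _<_; s≤s; _≟_)
  open import Data.Nat.Properties using (<-irrefl; <-trans; n<1+n; ≤-trans; n≤1+n; ≤∧≢⇒<; ≤-pred)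
  open import Data.Product using (_×_; _,_)
  open import Data.Sum using (inj₁; inj₂)
  open import Data.Empty using (⊥-elim)
  open import Relation.Nullary using (¬_; yes; no)
  open import Relation.Binary.PropositionalEquality

  transp-i : ∀ i → transp i i ≡ suc i
  transp-i i with i ≟ i
  ... | yes _ = refl
  ... | no ne = ⊥-elim (ne refl)

  transp-si : ∀ i → transp i (suc i) ≡ i
  transp-si i with i ≟ suc i
  ... | yes e = ⊥-elim (<-irrefl e (n<1+n i))
  ... | no _ with suc i ≟ suc i
  ...   | yes _ = refl
  ...   | no ne = ⊥-elim (ne refl)

  transp-other : ∀ i k → k ≢ i → k ≢ suc i → transp i k ≡ k
  transp-other i k k≢i k≢si with i ≟ k
  ... | yes e = ⊥-elim (k≢i (sym e))
  ... | no _ with suc i ≟ k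
  ...   | yes e = ⊥-elim (k≢si (sym e))
  ...   | no _ = refl

  data TranspCase (i k : ℕ) : Set where
    atLeft  : k ≡ i → TranspCase i k
    atRight : k ≡ suc i → TranspCase i k
    outside : k ≢ i → k ≢ suc i → TranspCase i k

  transpCase : ∀ i k → TranspCase i k
  transpCase i k with k ≟ i
  ... | yes e = atLeft e
  ... | no k≢i with k ≟ suc i
  ...   | yes e = atRight e
  ...   | no k≢si = outside k≢i k≢si

  transp-involutive : ∀ i k → transp i (transp i k) ≡ k
  transp-involutive i k with transpCase i k
  ... | atLeft refl = trans (cong (transp i) (transp-i i)) (transp-si i)
  ... | atRight refl = trans (cong (transp i) (transp-si i)) (transp-i i)
  ... | outside n₁ n₂ = trans (cong (transp i) (transp-other i k n₁ n₂)) (transp-other i k n₁ n₂)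

  transp-injective : ∀ i {x y} → transp i x ≡ transp i y → x ≡ y
  transp-injective i {x} {y} e = trans (sym (transp-involutive i x)) (trans (cong (transp i) e) (transp-involutive i y))

  transp-monotone : ∀ i {p q} → p < q → ¬ (p ≡ i × q ≡ suc i) → transp i p < transp i q
  transp-monotone i {p} {q} lt nc with transpCase i p | transpCase i q
  ... | atLeft refl | atLeft refl = ⊥-elim (<-irrefl refl lt)
  ... | atLeft refl | atRight refl = ⊥-elim (nc (refl , refl))
  ... | atLeft refl | outside n₁ n₂ rewrite transp-i i | transp-other i q n₁ n₂ = ≤∧≢⇒< lt (λ e → n₂ (sym e))
  ... | atRight refl | atLeft refl = ⊥-elim (<-irrefl refl (<-trans lt (n<1+n i)))
  ... | atRight refl | atRight refl = ⊥-elim (<-irrefl refl lt)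
  ... | atRight refl | outside n₁ n₂ rewrite transp-si i | transp-other i q n₁ n₂ = <-trans (n<1+n i) lt
  ... | outside n₁ n₂ | atLeft refl rewrite transp-i i | transp-other i p n₁ n₂ = <-trans lt (n<1+n i)
  ... | outside n₁ n₂ | atRight refl rewrite transp-si i | transp-other i p n₁ n₂ = ≤∧≢⇒< (≤-pred lt) n₁
  ... | outside n₁ n₂ | outside m₁ m₂ rewrite transp-other i p n₁ n₂ | transp-other i q m₁ m₂ = lt

  i≢1+i : ∀ i → i ≢ suc i
  i≢1+i i e = <-irrefl e (n<1+n i)

  i≢2+i : ∀ i → i ≢ suc (suc i)
  i≢2+i i e = <-irrefl e (<-trans (n<1+n i) (n<1+n (suc i)))

  transp-i-2+i : ∀ i → transp i (suc (suc i)) ≡ suc (suc i)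
  transp-i-2+i i = transp-other i (suc (suc i)) (λ e → i≢2+i i (sym e)) (λ e → i≢1+i (suc i) (sym e))

  transp-1+i-i : ∀ i → transp (suc i) i ≡ i
  transp-1+i-i i = transp-other (suc i) i (i≢1+i i) (i≢2+i i)

  data BraidCase (i k : ℕ) : Set where
    at0 : k ≡ i → BraidCase i k
    at1 : k ≡ suc i → BraidCase i k
    at2 : k ≡ suc (suc i) → BraidCase i k
    away : k ≢ i → k ≢ suc i → k ≢ suc (suc i) → BraidCase i k

  braidCase : ∀ i k → BraidCase i k
  braidCase i k with k ≟ i | k ≟ suc i | k ≟ suc (suc i)
  ... | yes e | _ | _ = at0 e
  ... | no _ | yes e | _ = at1 e
  ... | no _ | no _ | yes e = at2 e
  ... | no a | no b | no c = away a b c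

  transp-braid : ∀ i k → transp i (transp (suc i) (transp i k)) ≡ transp (suc i) (transp i (transp (suc i) k))
  transp-braid i k with braidCase i k
  ... | at0 refl rewrite transp-i i | transp-i (suc i) | transp-i-2+i i | transp-1+i-i i | transp-i i | transp-i (suc i) = refl
  ... | at1 refl rewrite transp-si i | transp-1+i-i i | transp-i i | transp-i (suc i) | transp-i-2+i i | transp-si (suc i) = refl
  ... | at2 refl rewrite transp-i-2+i i | transp-si (suc i) | transp-si i | transp-1+i-i i = refl
  ... | away a b c rewrite transp-other i k a b | transp-other (suc i) k b c | transp-other i k a b | transp-other (suc i) k b c = refl

  far-distinct : ∀ {i j} → Far i j → (j ≢ i) × (j ≢ suc i) × (suc j ≢ i) × (suc j ≢ suc i)
  far-distinct {i} {j} (inj₁ h) = (λ e → <-irrefl (sym e) (≤-trans (n≤1+n (suc i)) h)) , (λ e → <-irrefl (sym e) h) ,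
    (λ e → <-irrefl (sym e) (<-trans (≤-trans (n≤1+n (suc i)) h) (n<1+n j))) ,
    (λ e → <-irrefl (sym e) (≤-trans (s≤s (n≤1+n (suc i))) (s≤s h)))
  far-distinct {i} {j} (inj₂ h) = (λ e → <-irrefl e j<i) , (λ e → <-irrefl e (<-trans j<i (n<1+n i))) ,
    (λ e → <-irrefl e h) , (λ e → <-irrefl e (s≤s j<i))
    where
    j<i : j < i
    j<i = ≤-trans (n≤1+n (suc j)) h

  far-sym : ∀ {i j} → Far i j → Far j i
  far-sym (inj₁ h) = inj₂ h
  far-sym (inj₂ h) = inj₁ h

  transp-far : ∀ {i j} → Far i j → transp i j ≡ j
  transp-far h with far-distinct h
  ... | a , b , _ , _ = transp-other _ _ a b

  transp-far-suc : ∀ {i j} → Far i j → transp i (suc j) ≡ suc j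
  transp-far-suc h with far-distinct h
  ... | _ , _ , c , d = transp-other _ _ c d

  transp-commute : ∀ {i j} → Far i j → ∀ k → transp i (transp j k) ≡ transp j (transp i k)
  transp-commute {i} {j} h k with transpCase j k | transpCase i k
  ... | atLeft refl | _ rewrite transp-i j | transp-far-suc h | transp-far h | transp-i j = refl
  ... | atRight refl | _ rewrite transp-si j | transp-far h | transp-far-suc h | transp-si j = refl
  ... | outside _ _ | atLeft refl rewrite transp-far (far-sym h) | transp-i i | transp-far-suc (far-sym h) = refl
  ... | outside _ _ | atRight refl rewrite transp-far-suc (far-sym h) | transp-si i | transp-far (far-sym h) = refl
  ... | outside a b | outside c d rewrite transp-other j k a b | transp-other i k c d | transp-other j k a b = refl

module Strands where

  open Transpositions
  open import Data.Nat using (ℕ; suc; _≤_; _<_; s≤s; _≟_; _<?_)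
  open import Data.Nat.Properties
    using (<-irrefl; <-asym; n<1+n; ≤∧≢⇒<; ≮⇒≥; 1+n≰n; ≤-trans; ≤-reflexive; +-suc; +-monoʳ-≤; n≤1+n)
  open import Data.List using (List; []; _∷_; _++_; length)
  open import Data.List.Properties using (++-assoc; length-++; map-++)
  open import Data.List.Relation.Unary.All using (_∷_)
  open import Data.List.Relation.Unary.All.Properties using (++⁺; ++⁻ˡ; ++⁻ʳ)
  open import Data.Product using (_×_; Σ; _,_)
  open import Data.Sum using (_⊎_; inj₁; inj₂)
  open import Data.Empty using (⊥; ⊥-elim)
  open import Data.Unit using (⊤; tt)
  open import Relation.Nullary using (¬_; yes; no; Dec)
  open import Relation.Binary.PropositionalEquality

  -- A state s records the strand s k at each position k; the letter σ_i
  -- (or σ̄_i) exchanges the strands at positions i and i+1, and  after s w  is the state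
  -- reached by reading w from s.
  State : Set
  State = ℕ → ℕ

  idS : State
  idS k = k

  act : State → ℕ → State
  act s i k = s (transp i k)

  index : SLetter → ℕ
  index (pos i) = i
  index (neg i) = i

  after : State → SWord → State
  after s [] = s
  after s (x ∷ w) = after (act s (index x)) w

  after-++ : ∀ s a b → after s (a ++ b) ≡ after (after s a) b
  after-++ s [] b = refl
  after-++ s (x ∷ a) b = after-++ (act s (index x)) a b

  after-cong : ∀ {s s′} → (∀ k → s k ≡ s′ k) → ∀ w k → after s w k ≡ after s′ w k
  after-cong h [] k = h k
  after-cong h (x ∷ w) k = after-cong (λ k′ → h (transp (index x) k′)) w k

  after-post : ∀ (g : ℕ → ℕ) s w x → after (λ k → g (s k)) w x ≡ g (after s w x)
  after-post g s [] x = refl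
  after-post g s (y ∷ w) x = after-post g (act s (index y)) w x

  after-emb : ∀ s a b x → after s (emb (a ++ b)) x ≡ after (after s (emb a)) (emb b) x
  after-emb s a b x = trans (cong (λ w → after s w x) (map-++ pos a b)) (cong (λ f → f x) (after-++ s (emb a) (emb b)))

  perm-after : ∀ w x → perm w x ≡ after idS (emb w) x
  perm-after w x = sym (go idS w x)
    where
    go : ∀ s w k → after s (emb w) k ≡ s (perm w k)
    go s [] k = refl
    go s (i ∷ w) k = go (act s i) w k

  Inj : State → Set
  Inj s = ∀ {x y} → s x ≡ s y → x ≡ y

  after-inj : ∀ {s} w → Inj s → Inj (after s w)
  after-inj [] h = h
  after-inj (x ∷ w) h = after-inj w (λ e → transp-injective (index x) (h e))

  idS-inj : Inj idS
  idS-inj e = e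

  Before : State → ℕ → ℕ → Set
  Before s a b = Σ ℕ λ p → Σ ℕ λ q → p < q × s p ≡ a × s q ≡ b

  before-asym : ∀ {s a b} → Inj s → Before s a b → Before s b a → ⊥
  before-asym h (p , q , lt , e₁ , e₂) (p′ , q′ , lt′ , e₁′ , e₂′) with h (trans e₁ (sym e₂′)) | h (trans e₂ (sym e₁′))
  ... | refl | refl = <-asym lt lt′

  Cross : State → ℕ → ℕ → ℕ → Set
  Cross s i a b = (s i ≡ a × s (suc i) ≡ b) ⊎ (s i ≡ b × s (suc i) ≡ a)

  cross? : ∀ s i a b → Dec (Cross s i a b)
  cross? s i a b with s i ≟ a | s (suc i) ≟ b | s i ≟ b | s (suc i) ≟ a
  ... | yes e₁ | yes e₂ | _ | _ = yes (inj₁ (e₁ , e₂))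
  ... | _ | _ | yes e₃ | yes e₄ = yes (inj₂ (e₃ , e₄))
  ... | no n₁ | _ | no n₃ | _ = no λ { (inj₁ (x , _)) → n₁ x ; (inj₂ (x , _)) → n₃ x }
  ... | no n₁ | _ | yes _ | no n₄ = no λ { (inj₁ (x , _)) → n₁ x ; (inj₂ (_ , y)) → n₄ y }
  ... | yes _ | no n₂ | no n₃ | _ = no λ { (inj₁ (_ , y)) → n₂ y ; (inj₂ (x , _)) → n₃ x }
  ... | yes _ | no n₂ | yes _ | no n₄ = no λ { (inj₁ (_ , y)) → n₂ y ; (inj₂ (_ , y)) → n₄ y }

  before-preserved : ∀ {s a b} i → Before s a b → ¬ Cross s i a b → Before (act s i) a b
  before-preserved {s} i (p , q , lt , e₁ , e₂) nc =
    transp i p , transp i q , transp-monotone i lt (λ { (refl , refl) → nc (inj₁ (e₁ , e₂)) }) ,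
    trans (cong s (transp-involutive i p)) e₁ , trans (cong s (transp-involutive i q)) e₂

  firstCrossing : ∀ s p a b → Inj s → Before s a b → Before (after s (emb p)) b a →
    Σ (List ℕ) λ p₁ → Σ ℕ λ k → Σ (List ℕ) λ p₂ → p ≡ p₁ ++ k ∷ p₂ × Cross (after s (emb p₁)) k a b
  firstCrossing s [] a b h ab ba = ⊥-elim (before-asym h ab ba)
  firstCrossing s (k ∷ p) a b h ab ba with cross? s k a b
  ... | yes c = [] , k , p , refl , c
  ... | no nc with firstCrossing (act s k) p a b (after-inj (pos k ∷ []) h) (before-preserved k ab nc) ba
  ...   | p₁ , k′ , p₂ , refl , c = k ∷ p₁ , k′ , p₂ , refl , c

  swapValues : ℕ → ℕ → ℕ → ℕ
  swapValues a b x with x ≟ a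
  ... | yes _ = b
  ... | no _ with x ≟ b
  ...   | yes _ = a
  ...   | no _ = x

  swapValues-a : ∀ a b → swapValues a b a ≡ b
  swapValues-a a b with a ≟ a
  ... | yes _ = refl
  ... | no n = ⊥-elim (n refl)

  swapValues-b : ∀ a b → a ≢ b → swapValues a b b ≡ a
  swapValues-b a b ne with b ≟ a
  ... | yes e = ⊥-elim (ne (sym e))
  ... | no _ with b ≟ b
  ...   | yes _ = refl
  ...   | no n = ⊥-elim (n refl)

  swapValues-other : ∀ a b x → x ≢ a → x ≢ b → swapValues a b x ≡ x
  swapValues-other a b x n₁ n₂ with x ≟ a
  ... | yes e = ⊥-elim (n₁ e)
  ... | no _ with x ≟ b
  ...   | yes e = ⊥-elim (n₂ e)
  ...   | no _ = refl

  swapValues-involutive : ∀ a b x → a ≢ b → swapValues a b (swapValues a b x) ≡ x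
  swapValues-involutive a b x ne with x ≟ a
  ... | yes refl = swapValues-b a b ne
  ... | no n₁ with x ≟ b
  ...   | yes refl = swapValues-a a b
  ...   | no n₂ = swapValues-other a b x n₁ n₂

  act-crossing : ∀ {s} k a b → Inj s → Cross s k a b → ∀ x → act s k x ≡ swapValues a b (s x)
  act-crossing {s} k a b h c x with transpCase k x
  act-crossing {s} k a b h (inj₁ (e₁ , e₂)) x | atLeft refl rewrite transp-i k | e₁ | e₂ = sym (swapValues-a a b)
  act-crossing {s} k a b h (inj₂ (e₁ , e₂)) x | atLeft refl rewrite transp-i k | e₁ | e₂ =
    sym (swapValues-b a b (λ ab → i≢1+i k (h (trans e₁ (trans (sym ab) (sym e₂))))))
  act-crossing {s} k a b h (inj₁ (e₁ , e₂)) x | atRight refl rewrite transp-si k | e₁ | e₂ =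
    sym (swapValues-b a b (λ ab → i≢1+i k (h (trans e₁ (trans ab (sym e₂))))))
  act-crossing {s} k a b h (inj₂ (e₁ , e₂)) x | atRight refl rewrite transp-si k | e₁ | e₂ = sym (swapValues-a a b)
  act-crossing {s} k a b h c x | outside n₁ n₂ rewrite transp-other k x n₁ n₂ = sym (swapValues-other a b (s x) (≢a c) (≢b c))
    where
    ≢a : Cross s k a b → s x ≢ a
    ≢a (inj₁ (e₁ , e₂)) e = n₁ (h (trans e (sym e₁)))
    ≢a (inj₂ (e₁ , e₂)) e = n₂ (h (trans e (sym e₂)))
    ≢b : Cross s k a b → s x ≢ b
    ≢b (inj₁ (e₁ , e₂)) e = n₂ (h (trans e (sym e₂)))
    ≢b (inj₂ (e₁ , e₂)) e = n₁ (h (trans e (sym e₁)))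

  -- A word is good from state s when every σ_i crosses its strands from increasing to decreasing
  -- order and every σ̄_i the other way round; for positive words this means no two strands cross twice.
  Good : State → SWord → Set
  Good s [] = ⊤
  Good s (pos i ∷ w) = (s i < s (suc i)) × Good (act s i) w
  Good s (neg i ∷ w) = (s (suc i) < s i) × Good (act s i) w

  good-cong : ∀ {s s′} → (∀ k → s k ≡ s′ k) → ∀ w → Good s w → Good s′ w
  good-cong h [] g = tt
  good-cong h (pos i ∷ w) (lt , g) = subst₂ _<_ (h i) (h (suc i)) lt , good-cong (λ k → h (transp i k)) w g
  good-cong h (neg i ∷ w) (lt , g) = subst₂ _<_ (h (suc i)) (h i) lt , good-cong (λ k → h (transp i k)) w g

  good-++ˡ : ∀ s a b → Good s (a ++ b) → Good s a
  good-++ˡ s [] b g = tt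
  good-++ˡ s (pos i ∷ a) b (lt , g) = lt , good-++ˡ _ a b g
  good-++ˡ s (neg i ∷ a) b (lt , g) = lt , good-++ˡ _ a b g

  good-++ʳ : ∀ s a b → Good s (a ++ b) → Good (after s a) b
  good-++ʳ s [] b g = g
  good-++ʳ s (pos i ∷ a) b (lt , g) = good-++ʳ _ a b g
  good-++ʳ s (neg i ∷ a) b (lt , g) = good-++ʳ _ a b g

  good-++ : ∀ s a b → Good s a → Good (after s a) b → Good s (a ++ b)
  good-++ s [] b _ g = g
  good-++ s (pos i ∷ a) b (lt , g) g′ = lt , good-++ _ a b g g′
  good-++ s (neg i ∷ a) b (lt , g) g′ = lt , good-++ _ a b g g′

  deleteCrossings : ∀ p i q → after idS (emb p) (suc i) < after idS (emb p) i →
    Σ (List ℕ) λ p₁ → Σ ℕ λ k → Σ (List ℕ) λ p₂ → p ≡ p₁ ++ k ∷ p₂ ×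
      (∀ x → after idS (emb (p ++ i ∷ q)) x ≡ after idS (emb (p₁ ++ p₂ ++ q)) x)
  deleteCrossings p i q lt
    with firstCrossing idS p (after idS (emb p) (suc i)) (after idS (emb p) i) idS-inj
           (_ , _ , lt , refl , refl) (i , suc i , n<1+n i , refl , refl)
  ... | p₁ , k , p₂ , refl , c = p₁ , k , p₂ , refl , same-permutation
    where
    a : ℕ
    a = after idS (emb (p₁ ++ k ∷ p₂)) (suc i)
    b : ℕ
    b = after idS (emb (p₁ ++ k ∷ p₂)) i
    τ : State
    τ = after idS (emb p₁)
    T : State
    T = after τ (emb p₂)
    S : State
    S = after (act τ k) (emb p₂)
    -- reading p₁ k p₂ differs from reading p₁ p₂ exactly by exchanging the strands a and b
    S-swapped : ∀ x → S x ≡ swapValues a b (T x)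
    S-swapped x = trans (after-cong (act-crossing k a b (after-inj (emb p₁) idS-inj) c) (emb p₂) x)
                        (after-post (swapValues a b) τ (emb p₂) x)
    S-is-p : ∀ x → after idS (emb (p₁ ++ k ∷ p₂)) x ≡ S x
    S-is-p x = after-emb idS p₁ (k ∷ p₂) x
    -- and the letter σ_i crosses a and b once more, undoing the exchange
    undo : ∀ x → act S i x ≡ T x
    undo x = trans (act-crossing i a b (after-inj (emb p₂) (after-inj (pos k ∷ []) (after-inj (emb p₁) idS-inj)))
                     (inj₂ (sym (S-is-p i) , sym (S-is-p (suc i)))) x)
             (trans (cong (swapValues a b) (S-swapped x)) (swapValues-involutive a b (T x) (λ e → <-irrefl e lt)))
    same-permutation : ∀ x → after idS (emb ((p₁ ++ k ∷ p₂) ++ i ∷ q)) x ≡ after idS (emb (p₁ ++ p₂ ++ q)) x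
    same-permutation x = trans (after-emb idS (p₁ ++ k ∷ p₂) (i ∷ q) x)
             (trans (after-cong (λ y → trans (S-is-p (transp i y)) (undo y)) (emb q) x)
             (sym (trans (after-emb idS p₁ (p₂ ++ q) x) (after-emb τ p₂ q x))))

  delete-expr : ∀ {n} p₁ k p₂ i q → Expr n (p₁ ++ k ∷ p₂ ++ i ∷ q) → Expr n (p₁ ++ p₂ ++ q)
  delete-expr p₁ k p₂ i q ex with ++⁻ʳ p₁ ex
  ... | _ ∷ rest with ++⁻ʳ p₂ rest
  ...   | _ ∷ tl = ++⁺ (++⁻ˡ p₁ ex) (++⁺ (++⁻ˡ p₂ rest) tl)

  delete-shorter : ∀ p₁ (k : ℕ) p₂ i q → suc (length (p₁ ++ p₂ ++ q)) ≤ length (p₁ ++ k ∷ p₂ ++ i ∷ q)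
  delete-shorter p₁ k p₂ i q
    rewrite length-++ p₁ {k ∷ (p₂ ++ i ∷ q)} | length-++ p₁ {p₂ ++ q} | length-++ p₂ {i ∷ q} | length-++ p₂ {q} =
    ≤-trans (≤-reflexive (sym (+-suc (length p₁) _))) (+-monoʳ-≤ (length p₁) (s≤s (+-monoʳ-≤ (length p₂) (n≤1+n (length q)))))

  -- Reduced words are good: a reduced word never crosses two strands twice, since otherwise
  -- deleting both crossings would give a shorter equivalent expression.
  reduced-good : ∀ n u → Reduced n u → Good idS (emb u)
  reduced-good n u (ex , minimal) = go [] u refl
    where
    go : ∀ p q → u ≡ p ++ q → Good (after idS (emb p)) (emb q)
    go p [] e = tt
    go p (i ∷ q) e with after idS (emb p) i <? after idS (emb p) (suc i)
    ... | yes lt = lt , good-cong (λ k → after-emb idS p (i ∷ []) k) (emb q) (go (p ++ i ∷ []) q (trans e (sym (++-assoc p (i ∷ []) q))))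
    ... | no nlt
      with deleteCrossings p i q (≤∧≢⇒< (≮⇒≥ nlt) (λ e′ → i≢1+i i (sym (after-inj (emb p) idS-inj e′))))
    ...   | p₁ , k , p₂ , refl , same = ⊥-elim (1+n≰n (≤-trans shorter (minimal _ (delete-expr p₁ k p₂ i q ex′) equiv)))
      where
      u≡ : u ≡ p₁ ++ k ∷ (p₂ ++ i ∷ q)
      u≡ = trans e (++-assoc p₁ (k ∷ p₂) (i ∷ q))
      ex′ : Expr n (p₁ ++ k ∷ p₂ ++ i ∷ q)
      ex′ = subst (Expr n) u≡ ex
      equiv : Equiv u (p₁ ++ p₂ ++ q)
      equiv x = trans (cong (λ z → perm z x) e) (trans (perm-after ((p₁ ++ k ∷ p₂) ++ i ∷ q) x) (trans (same x) (sym (perm-after (p₁ ++ p₂ ++ q) x))))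
      shorter : suc (length (p₁ ++ p₂ ++ q)) ≤ length u
      shorter = subst (λ z → suc (length (p₁ ++ p₂ ++ q)) ≤ length z) (sym u≡) (delete-shorter p₁ k p₂ i q)

module Labels where

  open Transpositions
  open Strands
  open import Data.Nat using (ℕ; suc; _<_; z≤n; s≤s; _≟_; _⊓_; _⊔_)
  open import Data.Nat.Properties using (<-asym; n<1+n; <⇒≤; m≤n⇒m⊓n≡m; m≤n⇒m⊔n≡n; ⊓-comm; ⊔-comm)
  open import Data.List using (List; []; _∷_; _++_)
  open import Data.List.Relation.Unary.All using ([]; _∷_)
  open import Data.List.Relation.Unary.All.Properties using (¬Any⇒All¬; All¬⇒¬Any)
  open import Data.List.Relation.Unary.Any using (here; there)
  open import Data.List.Relation.Unary.Unique.Propositional using (Unique; []; _∷_)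
  open import Data.List.Relation.Binary.Sublist.Propositional using (_⊆_; []; _∷_; _∷ʳ_)
  open import Data.List.Relation.Binary.Sublist.Propositional.Properties using (All-resp-⊆; Any-resp-⊆)
  open import Data.List.Membership.Propositional using (_∈_; _∉_)
  open import Data.List.Membership.Propositional.Properties using (∈-++⁺ʳ)
  open import Data.Bool using (Bool; true; false)
  open import Data.Product using (_×_; _,_)
  open import Data.Product.Properties using (≡-dec)
  open import Data.Sum using (inj₁; inj₂)
  open import Data.Empty using (⊥-elim)
  open import Relation.Nullary using (yes; no; Dec)
  open import Relation.Binary.PropositionalEquality

  -- The label of a crossing is the (sorted) pair of strands it exchanges.
  Lab : Set
  Lab = ℕ × ℕ

  pair : ℕ → ℕ → Lab
  pair a b = a ⊓ b , a ⊔ b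

  pair-< : ∀ {a b} → a < b → pair a b ≡ (a , b)
  pair-< a<b = cong₂ _,_ (m≤n⇒m⊓n≡m (<⇒≤ a<b)) (m≤n⇒m⊔n≡n (<⇒≤ a<b))

  pair-sym : ∀ a b → pair a b ≡ pair b a
  pair-sym a b = cong₂ _,_ (⊓-comm a b) (⊔-comm a b)

  pair-> : ∀ {a b} → b < a → pair a b ≡ (b , a)
  pair-> {a} {b} b<a = trans (pair-sym a b) (pair-< b<a)

  labEq : (a b : Lab) → Dec (a ≡ b)
  labEq = ≡-dec _≟_ _≟_

  -- A signed label: true for a letter σ_i, false for σ̄_i.
  SL : Set
  SL = Bool × Lab

  sign : SLetter → Bool
  sign (pos _) = true
  sign (neg _) = false

  labelAt : State → ℕ → Lab
  labelAt s i = pair (s i) (s (suc i))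

  labs : State → SWord → List SL
  labs s [] = []
  labs s (x ∷ w) = (sign x , labelAt s (index x)) ∷ labs (act s (index x)) w

  labs-++ : ∀ s a b → labs s (a ++ b) ≡ labs s a ++ labs (after s a) b
  labs-++ s [] b = refl
  labs-++ s (x ∷ a) b = cong (_ ∷_) (labs-++ _ a b)

  labs-cong : ∀ {s s′} → (∀ k → s k ≡ s′ k) → ∀ w → labs s w ≡ labs s′ w
  labs-cong h [] = refl
  labs-cong h (x ∷ w) = cong₂ _∷_ (cong₂ (λ p q → sign x , pair p q) (h (index x)) (h (suc (index x))))
    (labs-cong (λ k → h (transp (index x) k)) w)

  posL : List SL → List Lab
  posL [] = []
  posL ((true , l) ∷ z) = l ∷ posL z
  posL ((false , l) ∷ z) = posL z

  posL-++ : ∀ a b → posL (a ++ b) ≡ posL a ++ posL b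
  posL-++ [] b = refl
  posL-++ ((true , l) ∷ a) b = cong (l ∷_) (posL-++ a b)
  posL-++ ((false , l) ∷ a) b = posL-++ a b

  posL-∈ : ∀ {l z} → (true , l) ∈ z → l ∈ posL z
  posL-∈ {z = (true , l′) ∷ z} (here refl) = here refl
  posL-∈ {z = (true , l′) ∷ z} (there m) = there (posL-∈ m)
  posL-∈ {z = (false , l′) ∷ z} (there m) = posL-∈ m

  label-absent : ∀ s w {a b} → Good s (emb w) → Inj s → a < b → Before s b a → (a , b) ∉ posL (labs s (emb w))
  label-absent s (i ∷ w) (lt , g) h a<b ba (here e) with trans (sym (pair-< lt)) (sym e)
  ... | refl = before-asym h (i , suc i , n<1+n i , refl , refl) ba
  label-absent s (i ∷ w) {a} {b} (lt , g) h a<b ba (there m) with cross? s i a b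
  ... | no nc = label-absent (act s i) w g (after-inj (pos i ∷ []) h) a<b
                  (before-preserved i ba (λ { (inj₁ (e₁ , e₂)) → nc (inj₂ (e₁ , e₂)) ; (inj₂ (e₁ , e₂)) → nc (inj₁ (e₁ , e₂)) })) m
  ... | yes (inj₁ (e₁ , e₂)) = before-asym h (i , suc i , n<1+n i , e₁ , e₂) ba
  ... | yes (inj₂ (e₁ , e₂)) = <-asym a<b (subst₂ _<_ e₁ e₂ lt)

  labels-unique : ∀ s w → Good s (emb w) → Inj s → Unique (posL (labs s (emb w)))
  labels-unique s [] g h = []
  labels-unique s (i ∷ w) (lt , g) h =
    ¬Any⇒All¬ _ (subst (_∉ posL (labs (act s i) (emb w))) (sym (pair-< lt))
      (label-absent (act s i) w g h′ lt (i , suc i , n<1+n i , cong s (transp-i i) , cong s (transp-si i))))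
    ∷ labels-unique (act s i) w g h′
    where
    h′ : Inj (act s i)
    h′ = after-inj (pos i ∷ []) h

  unique-⊆ : ∀ {A : Set} {xs ys : List A} → xs ⊆ ys → Unique ys → Unique xs
  unique-⊆ [] u = u
  unique-⊆ (y ∷ʳ τ) (_ ∷ u) = unique-⊆ τ u
  unique-⊆ (refl ∷ τ) (px ∷ u) = All-resp-⊆ τ px ∷ unique-⊆ τ u

  unique-disjoint : ∀ {A : Set} (xs : List A) {ys x} → Unique (xs ++ ys) → x ∈ xs → x ∉ ys
  unique-disjoint (x ∷ xs) (x∉ ∷ _) (here refl) m′ = All¬⇒¬Any x∉ (∈-++⁺ʳ xs m′)
  unique-disjoint (x ∷ xs) (_ ∷ u) (there m) m′ = unique-disjoint xs u m m′

  firstIdx : Lab → List Lab → ℕ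
  firstIdx a [] = 0
  firstIdx a (x ∷ xs) with labEq a x
  ... | yes _ = 0
  ... | no _ = suc (firstIdx a xs)

  firstIdx-here : ∀ a xs → firstIdx a (a ∷ xs) ≡ 0
  firstIdx-here a xs with labEq a a
  ... | yes _ = refl
  ... | no n = ⊥-elim (n refl)

  firstIdx-there : ∀ a x xs → a ≢ x → firstIdx a (x ∷ xs) ≡ suc (firstIdx a xs)
  firstIdx-there a x xs ne with labEq a x
  ... | yes e = ⊥-elim (ne e)
  ... | no _ = refl

  before-index : ∀ {A B L} → Unique L → A ∷ B ∷ [] ⊆ L → firstIdx A L < firstIdx B L
  before-index {A} {B} {_ ∷ L} (A∉ ∷ u) (refl ∷ τ) =
    subst₂ _<_ (sym (firstIdx-here A L)) (sym (firstIdx-there B A L B≢A)) (s≤s z≤n)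
    where
    B≢A : B ≢ A
    B≢A refl = All¬⇒¬Any A∉ (Any-resp-⊆ τ (here refl))
  before-index {A} {B} {x ∷ L} (x∉ ∷ u) (x ∷ʳ τ) =
    subst₂ _<_ (sym (firstIdx-there A x L A≢x)) (sym (firstIdx-there B x L B≢x)) (s≤s (before-index u τ))
    where
    A≢x : A ≢ x
    A≢x refl = All¬⇒¬Any x∉ (Any-resp-⊆ τ (here refl))
    B≢x : B ≢ x
    B≢x refl = All¬⇒¬Any x∉ (Any-resp-⊆ τ (there (here refl)))

module Blocks where

  open Transpositions
  open Strands
  open Labels
  open import Data.Nat using (ℕ; suc; _<_; _≟_; <-cmp)
  open import Data.Nat.Properties using (<-irrefl; <-trans; <-asym; ≤-total; m≤n⇒m⊓n≡m; m≤n⇒m⊔n≡n; m≥n⇒m⊓n≡n; m≥n⇒m⊔n≡m)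
  open import Data.List using ([]; _∷_)
  open import Data.Bool using (true; false)
  open import Data.Product using (_×_; _,_; proj₁; proj₂)
  open import Data.Sum using (_⊎_; inj₁; inj₂)
  open import Data.Empty using (⊥-elim)
  open import Data.Unit using (tt)
  open import Relation.Nullary using (¬_; Dec)
  open import Relation.Nullary.Decidable using (_×-dec_; _⊎-dec_; ¬?)
  open import Relation.Binary using (tri<; tri≈; tri>)
  open import Relation.Binary.PropositionalEquality

  -- Two labels form an item when they are disjoint pairs of strands or chained as (a , b), (b , c).
  -- The potential counts ordered items; a braid relation reverses the order of at most one item.
  Item : Lab → Lab → Set
  Item (a₁ , a₂) (b₁ , b₂) = (a₁ ≢ b₁ × a₁ ≢ b₂ × a₂ ≢ b₁ × a₂ ≢ b₂) ⊎ (a₂ ≡ b₁) ⊎ (b₂ ≡ a₁)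

  item? : ∀ A B → Dec (Item A B)
  item? (a₁ , a₂) (b₁ , b₂) =
    (¬? (a₁ ≟ b₁) ×-dec ¬? (a₁ ≟ b₂) ×-dec ¬? (a₂ ≟ b₁) ×-dec ¬? (a₂ ≟ b₂)) ⊎-dec (a₂ ≟ b₁) ⊎-dec (b₂ ≟ a₁)

  item-sym : ∀ {A B} → Item A B → Item B A
  item-sym (inj₁ (m₁ , m₂ , m₃ , m₄)) = inj₁ ((λ e → m₁ (sym e)) , (λ e → m₃ (sym e)) , (λ e → m₂ (sym e)) , (λ e → m₄ (sym e)))
  item-sym (inj₂ (inj₁ e)) = inj₂ (inj₂ e)
  item-sym (inj₂ (inj₂ e)) = inj₂ (inj₁ e)

  non-item-sym : ∀ {A B} → ¬ Item A B → ¬ Item B A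
  non-item-sym n i = n (item-sym i)

  data OneItem (A B C : Lab) : Set where
    itemAB : Item A B → ¬ Item A C → ¬ Item B C → OneItem A B C
    itemAC : ¬ Item A B → Item A C → ¬ Item B C → OneItem A B C
    itemBC : ¬ Item A B → ¬ Item A C → Item B C → OneItem A B C

  oneItem-reverse : ∀ {A B C} → OneItem A B C → OneItem C B A
  oneItem-reverse (itemAB a b c) = itemBC (non-item-sym c) (non-item-sym b) (item-sym a)
  oneItem-reverse (itemAC a b c) = itemAC (non-item-sym c) (item-sym b) (non-item-sym a)
  oneItem-reverse (itemBC a b c) = itemAB (item-sym c) (non-item-sym b) (non-item-sym a)

  module SortedTriangle {lo mid hi : ℕ} (l<m : lo < mid) (m<h : mid < hi) where
    chained : Item (lo , mid) (mid , hi)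
    chained = inj₂ (inj₁ refl)
    sameLow : ¬ Item (lo , mid) (lo , hi)
    sameLow (inj₁ (x , _)) = x refl
    sameLow (inj₂ (inj₁ e)) = <-irrefl (sym e) l<m
    sameLow (inj₂ (inj₂ e)) = <-irrefl (sym e) (<-trans l<m m<h)
    sameHigh : ¬ Item (lo , hi) (mid , hi)
    sameHigh (inj₁ (_ , _ , _ , x)) = x refl
    sameHigh (inj₂ (inj₁ e)) = <-irrefl (sym e) m<h
    sameHigh (inj₂ (inj₂ e)) = <-irrefl (sym e) (<-trans l<m m<h)

  triangle : ∀ x y z → x ≢ y → x ≢ z → y ≢ z → OneItem (pair x y) (pair x z) (pair y z)
  triangle x y z x≢y x≢z y≢z with <-cmp x y | <-cmp x z | <-cmp y z
  ... | tri≈ _ e _ | _ | _ = ⊥-elim (x≢y e)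
  ... | _ | tri≈ _ e _ | _ = ⊥-elim (x≢z e)
  ... | _ | _ | tri≈ _ e _ = ⊥-elim (y≢z e)
  ... | tri< xy _ _ | tri< xz _ _ | tri< yz _ _ rewrite pair-< xy | pair-< xz | pair-< yz =
    itemAC sameLow chained sameHigh where open SortedTriangle xy yz
  ... | tri< xy _ _ | tri< xz _ _ | tri> _ _ zy rewrite pair-< xy | pair-< xz | pair-> zy =
    itemBC (non-item-sym sameLow) sameHigh chained where open SortedTriangle xz zy
  ... | tri< xy _ _ | tri> _ _ zx | tri< yz _ _ = ⊥-elim (<-asym (<-trans xy yz) zx)
  ... | tri< xy _ _ | tri> _ _ zx | tri> _ _ zy rewrite pair-< xy | pair-> zx | pair-> zy =
    itemAB (item-sym chained) (non-item-sym sameHigh) sameLow where open SortedTriangle zx xy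
  ... | tri> _ _ yx | tri< xz _ _ | tri< yz _ _ rewrite pair-> yx | pair-< xz | pair-< yz =
    itemAB chained sameLow (non-item-sym sameHigh) where open SortedTriangle yx xz
  ... | tri> _ _ yx | tri< xz _ _ | tri> _ _ zy = ⊥-elim (<-asym (<-trans xz zy) yx)
  ... | tri> _ _ yx | tri> _ _ zx | tri< yz _ _ rewrite pair-> yx | pair-> zx | pair-< yz =
    itemBC sameHigh (non-item-sym sameLow) (item-sym chained) where open SortedTriangle yz zx
  ... | tri> _ _ yx | tri> _ _ zx | tri> _ _ zy rewrite pair-> yx | pair-> zx | pair-> zy =
    itemAC (non-item-sym sameHigh) (item-sym chained) (non-item-sym sameLow) where open SortedTriangle zy yx

  pair-cases : ∀ a b → (pair a b ≡ (a , b)) ⊎ (pair a b ≡ (b , a))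
  pair-cases a b with ≤-total a b
  ... | inj₁ a≤b = inj₁ (cong₂ _,_ (m≤n⇒m⊓n≡m a≤b) (m≤n⇒m⊔n≡n a≤b))
  ... | inj₂ b≤a = inj₂ (cong₂ _,_ (m≥n⇒m⊓n≡n b≤a) (m≥n⇒m⊔n≡m b≤a))

  disjoint-item : ∀ {a b c d} → a ≢ c → a ≢ d → b ≢ c → b ≢ d → Item (pair a b) (pair c d)
  disjoint-item {a} {b} {c} {d} n₁ n₂ n₃ n₄ with pair-cases a b | pair-cases c d
  ... | inj₁ e | inj₁ e′ = subst₂ Item (sym e) (sym e′) (inj₁ (n₁ , n₂ , n₃ , n₄))
  ... | inj₁ e | inj₂ e′ = subst₂ Item (sym e) (sym e′) (inj₁ (n₂ , n₁ , n₄ , n₃))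
  ... | inj₂ e | inj₁ e′ = subst₂ Item (sym e) (sym e′) (inj₁ (n₃ , n₄ , n₁ , n₂))
  ... | inj₂ e | inj₂ e′ = subst₂ Item (sym e) (sym e′) (inj₁ (n₄ , n₃ , n₂ , n₁))

  record ReversalII (σ : State) (i j : ℕ) : Set where
    field
      P Q : Lab
      labelsBefore : labs σ (neg i ∷ pos j ∷ []) ≡ (false , P) ∷ (true , Q) ∷ []
      labelsAfter : labs σ (pos j ∷ neg i ∷ []) ≡ (true , Q) ∷ (false , P) ∷ []
      sameState : ∀ k → after σ (neg i ∷ pos j ∷ []) k ≡ after σ (pos j ∷ neg i ∷ []) k
      isItem : Item P Q
      keepsGood : Good σ (neg i ∷ pos j ∷ []) → Good σ (pos j ∷ neg i ∷ [])

  reversalII : ∀ {σ i j} → Inj σ → Far i j → ReversalII σ i j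
  reversalII {σ} {i} {j} inj h = record
    { P = labelAt σ i ; Q = labelAt σ j
    ; labelsBefore = cong (λ z → (false , labelAt σ i) ∷ (true , z) ∷ []) (cong₂ pair (cong σ (transp-far h)) (cong σ (transp-far-suc h)))
    ; labelsAfter = cong (λ z → (true , labelAt σ j) ∷ (false , z) ∷ [])
                      (cong₂ pair (cong σ (transp-far (far-sym h))) (cong σ (transp-far-suc (far-sym h))))
    ; sameState = λ k → cong σ (transp-commute h k)
    ; isItem = disjoint-item (λ e → j≢i (sym (inj e))) (λ e → 1+j≢i (sym (inj e))) (λ e → j≢1+i (sym (inj e)))
                             (λ e → 1+j≢1+i (sym (inj e)))
    ; keepsGood = λ { (g₁ , g₂ , _) →
        subst₂ _<_ (cong σ (transp-far h)) (cong σ (transp-far-suc h)) g₂ ,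
        subst₂ _<_ (cong σ (sym (transp-far-suc (far-sym h)))) (cong σ (sym (transp-far (far-sym h)))) g₁ , tt }
    }
    where
    j≢i : j ≢ i
    j≢i = proj₁ (far-distinct h)
    j≢1+i : j ≢ suc i
    j≢1+i = proj₁ (proj₂ (far-distinct h))
    1+j≢i : suc j ≢ i
    1+j≢i = proj₁ (proj₂ (proj₂ (far-distinct h)))
    1+j≢1+i : suc j ≢ suc i
    1+j≢1+i = proj₂ (proj₂ (proj₂ (far-distinct h)))

  record ReversalI (σ : State) (i j : ℕ) : Set where
    field
      P Q R : Lab
      labelsBefore : labs σ (neg i ∷ pos j ∷ []) ≡ (false , P) ∷ (true , Q) ∷ []
      labelsAfter : labs σ (pos j ∷ pos i ∷ neg j ∷ neg i ∷ []) ≡ (true , R) ∷ (true , Q) ∷ (false , P) ∷ (false , R) ∷ []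
      sameState : ∀ k → after σ (neg i ∷ pos j ∷ []) k ≡ after σ (pos j ∷ pos i ∷ neg j ∷ neg i ∷ []) k
      oneItem : OneItem P Q R
      keepsGood : Good σ (neg i ∷ pos j ∷ []) → Good σ (pos j ∷ pos i ∷ neg j ∷ neg i ∷ [])

  triangle-at : ∀ {σ} i → Inj σ →
    OneItem (pair (σ i) (σ (suc i))) (pair (σ i) (σ (suc (suc i)))) (pair (σ (suc i)) (σ (suc (suc i))))
  triangle-at {σ} i inj = triangle _ _ _ (λ e → i≢1+i i (inj e)) (λ e → i≢2+i i (inj e)) (λ e → i≢1+i (suc i) (inj e))

  reversalI-up : ∀ {σ} i → Inj σ → ReversalI σ i (suc i)
  reversalI-up {σ} i inj = record
    { P = pair x y ; Q = pair x z ; R = pair y z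
    ; labelsBefore = cong (λ q → (false , pair x y) ∷ (true , q) ∷ []) (cong₂ pair (cong σ (transp-si i)) (cong σ (transp-i-2+i i)))
    ; labelsAfter = cong₂ (λ p q → (true , pair y z) ∷ (true , p) ∷ q) (cong₂ pair (cong σ e₁) (cong σ e₂))
        (cong₂ (λ p q → (false , p) ∷ (false , q) ∷ []) (cong₂ pair (cong σ e₃) (cong σ e₄))
          (trans (cong₂ pair (cong σ e₅) (cong σ e₆)) (pair-sym z y)))
    ; sameState = λ k → cong σ (trans (sym (cong (λ q → transp i (transp (suc i) q)) (transp-involutive i k)))
                                      (transp-braid i (transp i k)))
    ; oneItem = triangle-at i inj
    ; keepsGood = λ { (y<x , x<z′ , _) → let x<z = subst₂ _<_ (cong σ (transp-si i)) (cong σ (transp-i-2+i i)) x<z′ in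
        <-trans y<x x<z , subst₂ _<_ (cong σ (sym e₁)) (cong σ (sym e₂)) x<z ,
        subst₂ _<_ (cong σ (sym e₄)) (cong σ (sym e₃)) y<x , subst₂ _<_ (cong σ (sym e₆)) (cong σ (sym e₅)) (<-trans y<x x<z) , tt }
    }
    where
    x : ℕ
    x = σ i
    y : ℕ
    y = σ (suc i)
    z : ℕ
    z = σ (suc (suc i))
    e₁ : transp (suc i) i ≡ i
    e₁ = transp-1+i-i i
    e₂ : transp (suc i) (suc i) ≡ suc (suc i)
    e₂ = transp-i (suc i)
    e₃ : transp (suc i) (transp i (suc i)) ≡ i
    e₃ = trans (cong (transp (suc i)) (transp-si i)) (transp-1+i-i i)
    e₄ : transp (suc i) (transp i (suc (suc i))) ≡ suc i
    e₄ = trans (cong (transp (suc i)) (transp-i-2+i i)) (transp-si (suc i))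
    e₅ : transp (suc i) (transp i (transp (suc i) i)) ≡ suc (suc i)
    e₅ = trans (cong (λ q → transp (suc i) (transp i q)) (transp-1+i-i i)) (trans (cong (transp (suc i)) (transp-i i)) (transp-i (suc i)))
    e₆ : transp (suc i) (transp i (transp (suc i) (suc i))) ≡ suc i
    e₆ = trans (cong (λ q → transp (suc i) (transp i q)) (transp-i (suc i))) e₄

  reversalI-down : ∀ {σ} j → Inj σ → ReversalI σ (suc j) j
  reversalI-down {σ} j inj = record
    { P = pair y z ; Q = pair x z ; R = pair x y
    ; labelsBefore = cong (λ q → (false , pair y z) ∷ (true , q) ∷ []) (cong₂ pair (cong σ (transp-1+i-i j)) (cong σ (transp-i (suc j))))
    ; labelsAfter = cong₂ (λ p q → (true , pair x y) ∷ (true , p) ∷ q) (cong₂ pair (cong σ f₁) (cong σ f₂))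
        (cong₂ (λ p q → (false , p) ∷ (false , q) ∷ []) (cong₂ pair (cong σ f₃) (cong σ f₄))
          (trans (cong₂ pair (cong σ f₅) (cong σ f₆)) (pair-sym y x)))
    ; sameState = λ k → cong σ (sym (trans (transp-braid j (transp (suc j) k))
                                          (cong (λ q → transp (suc j) (transp j q)) (transp-involutive (suc j) k))))
    ; oneItem = oneItem-reverse (triangle-at j inj)
    ; keepsGood = λ { (z<y , x<z′ , _) → let x<z = subst₂ _<_ (cong σ (transp-1+i-i j)) (cong σ (transp-i (suc j))) x<z′ in
        <-trans x<z z<y , subst₂ _<_ (cong σ (sym f₁)) (cong σ (sym f₂)) x<z ,
        subst₂ _<_ (cong σ (sym f₄)) (cong σ (sym f₃)) z<y , subst₂ _<_ (cong σ (sym f₆)) (cong σ (sym f₅)) (<-trans x<z z<y) , tt }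
    }
    where
    x : ℕ
    x = σ j
    y : ℕ
    y = σ (suc j)
    z : ℕ
    z = σ (suc (suc j))
    f₁ : transp j (suc j) ≡ j
    f₁ = transp-si j
    f₂ : transp j (suc (suc j)) ≡ suc (suc j)
    f₂ = transp-i-2+i j
    f₃ : transp j (transp (suc j) j) ≡ suc j
    f₃ = trans (cong (transp j) (transp-1+i-i j)) (transp-i j)
    f₄ : transp j (transp (suc j) (suc j)) ≡ suc (suc j)
    f₄ = trans (cong (transp j) (transp-i (suc j))) (transp-i-2+i j)
    f₅ : transp j (transp (suc j) (transp j (suc j))) ≡ suc j
    f₅ = trans (cong (λ q → transp j (transp (suc j) q)) (transp-si j)) f₃
    f₆ : transp j (transp (suc j) (transp j (suc (suc j)))) ≡ j
    f₆ = trans (cong (λ q → transp j (transp (suc j) q)) (transp-i-2+i j)) (trans (cong (transp j) (transp-si (suc j))) (transp-si j))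

  reversalI : ∀ {σ i j} → Inj σ → Adj i j → ReversalI σ i j
  reversalI {i = i} inj (inj₁ refl) = reversalI-up i inj
  reversalI {j = j} inj (inj₂ refl) = reversalI-down j inj

  record BraidI (σ : State) (i j : ℕ) : Set where
    field
      α β γ : Lab
      labelsBefore : labs σ (emb (i ∷ j ∷ i ∷ [])) ≡ (true , α) ∷ (true , β) ∷ (true , γ) ∷ []
      labelsAfter : labs σ (emb (j ∷ i ∷ j ∷ [])) ≡ (true , γ) ∷ (true , β) ∷ (true , α) ∷ []
      sameState : ∀ k → after σ (emb (i ∷ j ∷ i ∷ [])) k ≡ after σ (emb (j ∷ i ∷ j ∷ [])) k
      oneItem : OneItem α β γ

  module _ {σ : State} (i : ℕ) where
    private
      x : ℕ
      x = σ i
      y : ℕ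
      y = σ (suc i)
      z : ℕ
      z = σ (suc (suc i))

    labels-up : labs σ (emb (i ∷ suc i ∷ i ∷ [])) ≡ (true , pair x y) ∷ (true , pair x z) ∷ (true , pair y z) ∷ []
    labels-up = cong₂ (λ p q → (true , pair x y) ∷ (true , p) ∷ (true , q) ∷ [])
      (cong₂ pair (cong σ (transp-si i)) (cong σ (transp-i-2+i i)))
      (cong₂ pair (cong σ (trans (cong (transp i) (transp-1+i-i i)) (transp-i i))) (cong σ (trans (cong (transp i) (transp-i (suc i))) (transp-i-2+i i))))

    labels-down : labs σ (emb (suc i ∷ i ∷ suc i ∷ [])) ≡ (true , pair y z) ∷ (true , pair x z) ∷ (true , pair x y) ∷ []
    labels-down = cong₂ (λ p q → (true , pair y z) ∷ (true , p) ∷ (true , q) ∷ [])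
      (cong₂ pair (cong σ (transp-1+i-i i)) (cong σ (transp-i (suc i))))
      (cong₂ pair (cong σ (trans (cong (transp (suc i)) (transp-si i)) (transp-1+i-i i)))
                  (cong σ (trans (cong (transp (suc i)) (transp-i-2+i i)) (transp-si (suc i)))))

  braidI : ∀ {σ i j} → Inj σ → Adj i j → BraidI σ i j
  braidI {σ} {i} inj (inj₁ refl) = record
    { α = pair (σ i) (σ (suc i)) ; β = pair (σ i) (σ (suc (suc i))) ; γ = pair (σ (suc i)) (σ (suc (suc i)))
    ; labelsBefore = labels-up {σ} i ; labelsAfter = labels-down {σ} i
    ; sameState = λ k → cong σ (transp-braid i k)
    ; oneItem = triangle-at i inj }
  braidI {σ} {j = j} inj (inj₂ refl) = record
    { α = pair (σ (suc j)) (σ (suc (suc j))) ; β = pair (σ j) (σ (suc (suc j))) ; γ = pair (σ j) (σ (suc j))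
    ; labelsBefore = labels-down {σ} j ; labelsAfter = labels-up {σ} j
    ; sameState = λ k → cong σ (sym (transp-braid j k))
    ; oneItem = oneItem-reverse (triangle-at j inj) }

  record BraidII (σ : State) (i j : ℕ) : Set where
    field
      P Q : Lab
      labelsBefore : labs σ (emb (i ∷ j ∷ [])) ≡ (true , P) ∷ (true , Q) ∷ []
      labelsAfter : labs σ (emb (j ∷ i ∷ [])) ≡ (true , Q) ∷ (true , P) ∷ []
      sameState : ∀ k → after σ (emb (i ∷ j ∷ [])) k ≡ after σ (emb (j ∷ i ∷ [])) k

  braidII : ∀ {σ i j} → Far i j → BraidII σ i j
  braidII {σ} {i} {j} h = record
    { P = labelAt σ i ; Q = labelAt σ j
    ; labelsBefore = cong (λ z → (true , labelAt σ i) ∷ (true , z) ∷ []) (cong₂ pair (cong σ (transp-far h)) (cong σ (transp-far-suc h)))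
    ; labelsAfter = cong (λ z → (true , labelAt σ j) ∷ (true , z) ∷ [])
                      (cong₂ pair (cong σ (transp-far (far-sym h))) (cong σ (transp-far-suc (far-sym h))))
    ; sameState = λ k → cong σ (transp-commute h k) }

module Potential where

  open Labels using (Lab; SL)
  open import Data.Integer using (ℤ; _+_; _*_; -_; _-_; 0ℤ; 1ℤ; -1ℤ)
  open import Data.Integer.Properties using (+-identityˡ; +-assoc)
  open import Data.Integer.Tactic.RingSolver using (solve-∀)
  open import Data.Bool using (Bool; true; false)
  open import Data.List using (List; []; _∷_; _++_)
  open import Data.List.Properties using (++-assoc)
  open import Data.Product using (_,_)
  open import Relation.Binary.PropositionalEquality

  -- Changing the sign of a label, and the mirror image of a signed label list: reversed, with
  -- all signs flipped (the labels of ū are the mirror image of those of u).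
  flipS : SL → SL
  flipS (true , l) = false , l
  flipS (false , l) = true , l

  mirL : List SL → List SL
  mirL [] = []
  mirL (a ∷ z) = mirL z ++ flipS a ∷ []

  sgnℤ : Bool → ℤ
  sgnℤ true = 1ℤ
  sgnℤ false = -1ℤ

  module Weighted (f : Lab → Lab → ℤ) where

    term : SL → SL → ℤ
    term (s₁ , l₁) (s₂ , l₂) = sgnℤ s₁ * sgnℤ s₂ * f l₁ l₂

    row : SL → List SL → ℤ
    row a [] = 0ℤ
    row a (b ∷ z) = term a b + row a z

    col : List SL → SL → ℤ
    col [] c = 0ℤ
    col (a ∷ z) c = term a c + col z c

    Λ : List SL → ℤ
    Λ [] = 0ℤ
    Λ (a ∷ z) = row a z + Λ z

    cross : List SL → List SL → ℤ
    cross [] q = 0ℤ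
    cross (a ∷ p) q = row a q + cross p q

    row-++ : ∀ a p q → row a (p ++ q) ≡ row a p + row a q
    row-++ a [] q = sym (+-identityˡ _)
    row-++ a (b ∷ p) q rewrite row-++ a p q = sym (+-assoc (term a b) _ _)

    col-++ : ∀ p q c → col (p ++ q) c ≡ col p c + col q c
    col-++ [] q c = sym (+-identityˡ _)
    col-++ (b ∷ p) q c rewrite col-++ p q c = sym (+-assoc (term b c) _ _)

    cross-[] : ∀ B → cross B [] ≡ 0ℤ
    cross-[] [] = refl
    cross-[] (a ∷ B) rewrite cross-[] B = refl

    cross-++ʳ : ∀ p q r → cross p (q ++ r) ≡ cross p q + cross p r
    cross-++ʳ [] q r = refl
    cross-++ʳ (a ∷ p) q r rewrite cross-++ʳ p q r | row-++ a q r = interchange (row a q) (row a r) (cross p q) (cross p r)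
      where
      interchange : ∀ a b c d → a + b + (c + d) ≡ a + c + (b + d)
      interchange = solve-∀

    cross-∷ʳ : ∀ p c q → cross p (c ∷ q) ≡ col p c + cross p q
    cross-∷ʳ [] c q = refl
    cross-∷ʳ (a ∷ p) c q rewrite cross-∷ʳ p c q = interchange (term a c) (row a q) (col p c) (cross p q)
      where
      interchange : ∀ a b c d → a + b + (c + d) ≡ a + c + (b + d)
      interchange = solve-∀

    Λ-++ : ∀ p q → Λ (p ++ q) ≡ Λ p + Λ q + cross p q
    Λ-++ [] q = identity (Λ q)
      where
      identity : ∀ a → a ≡ 0ℤ + a + 0ℤ
      identity = solve-∀
    Λ-++ (a ∷ p) q rewrite Λ-++ p q | row-++ a p q = regroup (row a p) (row a q) (Λ p) (Λ q) (cross p q)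
      where
      regroup : ∀ a b c d x → a + b + (c + d + x) ≡ a + c + d + (b + x)
      regroup = solve-∀

    cross-congˡ : ∀ B B′ q → (∀ c → col B c ≡ col B′ c) → cross B q ≡ cross B′ q
    cross-congˡ B B′ [] h = trans (cross-[] B) (sym (cross-[] B′))
    cross-congˡ B B′ (c ∷ q) h rewrite cross-∷ʳ B c q | cross-∷ʳ B′ c q | h c | cross-congˡ B B′ q h = refl

    cross-congʳ : ∀ p B B′ → (∀ a → row a B ≡ row a B′) → cross p B ≡ cross p B′
    cross-congʳ [] B B′ h = refl
    cross-congʳ (a ∷ p) B B′ h rewrite h a | cross-congʳ p B B′ h = refl

    replace : ∀ pre B B′ suf → (∀ a → row a B ≡ row a B′) → (∀ c → col B c ≡ col B′ c) →
      Λ (pre ++ B′ ++ suf) ≡ Λ (pre ++ B ++ suf) + (Λ B′ - Λ B)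
    replace pre B B′ suf hr hc
      rewrite Λ-++ pre (B ++ suf) | Λ-++ pre (B′ ++ suf) | Λ-++ B suf | Λ-++ B′ suf
            | cross-++ʳ pre B suf | cross-++ʳ pre B′ suf
            | cross-congʳ pre B B′ hr | cross-congˡ B B′ suf hc =
      regroup (Λ pre) (Λ B) (Λ B′) (Λ suf) (cross B′ suf) (cross pre B′) (cross pre suf)
      where
      regroup : ∀ p b b′ s x y z → p + (b′ + s + x) + (y + z) ≡ p + (b + s + x) + (y + z) + (b′ - b)
      regroup = solve-∀

    replace⁻ : ∀ pre B B′ suf → (∀ a → row a B ≡ row a B′) → (∀ c → col B c ≡ col B′ c) →
      Λ (pre ++ B ++ suf) ≡ Λ (pre ++ B′ ++ suf) + (Λ B - Λ B′)
    replace⁻ pre B B′ suf hr hc = undo _ _ (Λ B) (Λ B′) (replace pre B B′ suf hr hc)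
      where
      undo : ∀ a a′ b b′ → a′ ≡ a + (b′ - b) → a ≡ a′ + (b - b′)
      undo a a′ b b′ refl = cancel a b b′
        where
        cancel : ∀ a b b′ → a ≡ a + (b′ - b) + (b - b′)
        cancel = solve-∀

    term-flipʳ : ∀ a b → term a (flipS b) ≡ - term a b
    term-flipʳ (s₁ , l₁) (true , l₂) = negate (sgnℤ s₁) (f l₁ l₂)
      where
      negate : ∀ a x → a * -1ℤ * x ≡ - (a * 1ℤ * x)
      negate = solve-∀
    term-flipʳ (s₁ , l₁) (false , l₂) = negate (sgnℤ s₁) (f l₁ l₂)
      where
      negate : ∀ a x → a * 1ℤ * x ≡ - (a * -1ℤ * x)
      negate = solve-∀

    term-flipˡ : ∀ a b → term (flipS a) b ≡ - term a b
    term-flipˡ (true , l₁) (s₂ , l₂) = negate (sgnℤ s₂) (f l₁ l₂)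
      where
      negate : ∀ a x → -1ℤ * a * x ≡ - (1ℤ * a * x)
      negate = solve-∀
    term-flipˡ (false , l₁) (s₂ , l₂) = negate (sgnℤ s₂) (f l₁ l₂)
      where
      negate : ∀ a x → 1ℤ * a * x ≡ - (-1ℤ * a * x)
      negate = solve-∀

    private
      neg-sum : ∀ r t → - r + (- t + 0ℤ) ≡ - (t + r)
      neg-sum = solve-∀

      cancel : ∀ r → r + - r ≡ 0ℤ
      cancel = solve-∀

    row-mirL : ∀ a z → row a (mirL z) ≡ - row a z
    row-mirL a [] = refl
    row-mirL a (b ∷ z) = trans (row-++ a (mirL z) (flipS b ∷ []))
      (trans (cong₂ _+_ (row-mirL a z) (cong (_+ 0ℤ) (term-flipʳ a b))) (neg-sum (row a z) (term a b)))

    col-mirL : ∀ z c → col (mirL z) c ≡ - col z c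
    col-mirL [] c = refl
    col-mirL (b ∷ z) c = trans (col-++ (mirL z) (flipS b ∷ []) c)
      (trans (cong₂ _+_ (col-mirL z c) (cong (_+ 0ℤ) (term-flipˡ b c))) (neg-sum (col z c) (term b c)))

    row-mirrored : ∀ a z → row a (z ++ mirL z) ≡ 0ℤ
    row-mirrored a z rewrite row-++ a z (mirL z) | row-mirL a z = cancel (row a z)

    col-mirrored : ∀ z c → col (z ++ mirL z) c ≡ 0ℤ
    col-mirrored z c rewrite col-++ z (mirL z) c | col-mirL z c = cancel (col z c)

    module Diagonal (f-diag : ∀ l → f l l ≡ 0ℤ) where

      term-self : ∀ a → term a (flipS a) ≡ 0ℤ
      term-self (true , l) rewrite f-diag l = refl
      term-self (false , l) rewrite f-diag l = refl

      Λ-mirrored : ∀ z → Λ (z ++ mirL z) ≡ 0ℤ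
      Λ-mirrored [] = refl
      Λ-mirrored (a ∷ z)
        rewrite sym (++-assoc z (mirL z) (flipS a ∷ []))
              | row-++ a (z ++ mirL z) (flipS a ∷ []) | row-mirrored a z | term-self a
              | Λ-++ (z ++ mirL z) (flipS a ∷ []) | Λ-mirrored z | cross-∷ʳ (z ++ mirL z) (flipS a) []
              | col-mirrored z (flipS a) | cross-[] (z ++ mirL z) = refl

      cross-invisible : ∀ A B → (∀ a → row a B ≡ 0ℤ) → cross A B ≡ 0ℤ
      cross-invisible [] B h = refl
      cross-invisible (a ∷ A) B h rewrite h a | cross-invisible A B h = refl

      Λ-mirrored₂ : ∀ z w → Λ ((z ++ mirL z) ++ (w ++ mirL w)) ≡ 0ℤ
      Λ-mirrored₂ z w rewrite Λ-++ (z ++ mirL z) (w ++ mirL w) | Λ-mirrored z | Λ-mirrored w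
                            | cross-invisible (z ++ mirL z) (w ++ mirL w) (λ a → row-mirrored a w) = refl

    private
      swap₂ : ∀ x y → x + (y + 0ℤ) ≡ y + (x + 0ℤ)
      swap₂ = solve-∀

      swap₃ : ∀ x y z → x + (y + (z + 0ℤ)) ≡ z + (y + (x + 0ℤ))
      swap₃ = solve-∀

    row-II : ∀ a P Q → row a ((false , P) ∷ (true , Q) ∷ []) ≡ row a ((true , Q) ∷ (false , P) ∷ [])
    row-II (s , l) P Q = swap₂ (sgnℤ s * -1ℤ * f l P) (sgnℤ s * 1ℤ * f l Q)

    col-II : ∀ c P Q → col ((false , P) ∷ (true , Q) ∷ []) c ≡ col ((true , Q) ∷ (false , P) ∷ []) c
    col-II (s , l) P Q = swap₂ (-1ℤ * sgnℤ s * f P l) (1ℤ * sgnℤ s * f Q l)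

    Δ-II : ∀ P Q → Λ ((true , Q) ∷ (false , P) ∷ []) - Λ ((false , P) ∷ (true , Q) ∷ []) ≡ f P Q - f Q P
    Δ-II P Q = expand (f Q P) (f P Q)
      where
      expand : ∀ a b → (1ℤ * -1ℤ * a + 0ℤ + (0ℤ + 0ℤ)) - (-1ℤ * 1ℤ * b + 0ℤ + (0ℤ + 0ℤ)) ≡ b - a
      expand = solve-∀

    row-I : ∀ a P Q R → row a ((false , P) ∷ (true , Q) ∷ []) ≡ row a ((true , R) ∷ (true , Q) ∷ (false , P) ∷ (false , R) ∷ [])
    row-I (s , l) P Q R = expand (sgnℤ s) (f l P) (f l Q) (f l R)
      where
      expand : ∀ x p q r → x * -1ℤ * p + (x * 1ℤ * q + 0ℤ) ≡ x * 1ℤ * r + (x * 1ℤ * q + (x * -1ℤ * p + (x * -1ℤ * r + 0ℤ)))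
      expand = solve-∀

    col-I : ∀ c P Q R → col ((false , P) ∷ (true , Q) ∷ []) c ≡ col ((true , R) ∷ (true , Q) ∷ (false , P) ∷ (false , R) ∷ []) c
    col-I (s , l) P Q R = expand (sgnℤ s) (f P l) (f Q l) (f R l)
      where
      expand : ∀ x p q r → -1ℤ * x * p + (1ℤ * x * q + 0ℤ) ≡ 1ℤ * x * r + (1ℤ * x * q + (-1ℤ * x * p + (-1ℤ * x * r + 0ℤ)))
      expand = solve-∀

    Δ-I : ∀ P Q R → Λ ((true , R) ∷ (true , Q) ∷ (false , P) ∷ (false , R) ∷ []) - Λ ((false , P) ∷ (true , Q) ∷ [])
         ≡ (f R Q - f Q R) + (f P R - f R P) + (f P Q - f Q P) - f R R
    Δ-I P Q R = expand (f R Q) (f R P) (f R R) (f Q P) (f Q R) (f P R) (f P Q)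
      where
      expand : ∀ rq rp rr qp qr pr pq →
        (1ℤ * 1ℤ * rq + (1ℤ * -1ℤ * rp + (1ℤ * -1ℤ * rr + 0ℤ)) + (1ℤ * -1ℤ * qp + (1ℤ * -1ℤ * qr + 0ℤ) + (-1ℤ * -1ℤ * pr + 0ℤ + 0ℤ)))
        - (-1ℤ * 1ℤ * pq + 0ℤ + 0ℤ) ≡ (rq - qr) + (pr - rp) + (pq - qp) - rr
      expand = solve-∀

    row-B2 : ∀ a P Q → row a ((true , P) ∷ (true , Q) ∷ []) ≡ row a ((true , Q) ∷ (true , P) ∷ [])
    row-B2 (s , l) P Q = swap₂ (sgnℤ s * 1ℤ * f l P) (sgnℤ s * 1ℤ * f l Q)

    col-B2 : ∀ c P Q → col ((true , P) ∷ (true , Q) ∷ []) c ≡ col ((true , Q) ∷ (true , P) ∷ []) c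
    col-B2 (s , l) P Q = swap₂ (1ℤ * sgnℤ s * f P l) (1ℤ * sgnℤ s * f Q l)

    Δ-B2 : ∀ P Q → Λ ((true , P) ∷ (true , Q) ∷ []) - Λ ((true , Q) ∷ (true , P) ∷ []) ≡ f P Q - f Q P
    Δ-B2 P Q = expand (f P Q) (f Q P)
      where
      expand : ∀ a b → (1ℤ * 1ℤ * a + 0ℤ + (0ℤ + 0ℤ)) - (1ℤ * 1ℤ * b + 0ℤ + (0ℤ + 0ℤ)) ≡ a - b
      expand = solve-∀

    row-B1 : ∀ a A B C → row a ((true , A) ∷ (true , B) ∷ (true , C) ∷ []) ≡ row a ((true , C) ∷ (true , B) ∷ (true , A) ∷ [])
    row-B1 (s , l) A B C = swap₃ (sgnℤ s * 1ℤ * f l A) (sgnℤ s * 1ℤ * f l B) (sgnℤ s * 1ℤ * f l C)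

    col-B1 : ∀ c A B C → col ((true , A) ∷ (true , B) ∷ (true , C) ∷ []) c ≡ col ((true , C) ∷ (true , B) ∷ (true , A) ∷ []) c
    col-B1 (s , l) A B C = swap₃ (1ℤ * sgnℤ s * f A l) (1ℤ * sgnℤ s * f B l) (1ℤ * sgnℤ s * f C l)

    Δ-B1 : ∀ A B C → Λ ((true , A) ∷ (true , B) ∷ (true , C) ∷ []) - Λ ((true , C) ∷ (true , B) ∷ (true , A) ∷ [])
         ≡ (f A B - f B A) + (f A C - f C A) + (f B C - f C B)
    Δ-B1 A B C = expand (f A B) (f A C) (f B C) (f C B) (f C A) (f B A)
      where
      expand : ∀ ab ac bc cb ca ba →
        (1ℤ * 1ℤ * ab + (1ℤ * 1ℤ * ac + 0ℤ) + (1ℤ * 1ℤ * bc + 0ℤ + 0ℤ)) - (1ℤ * 1ℤ * cb + (1ℤ * 1ℤ * ca + 0ℤ) + (1ℤ * 1ℤ * ba + 0ℤ + 0ℤ))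
        ≡ (ab - ba) + (ac - ca) + (bc - cb)
      expand = solve-∀

module Nesting where

  open Labels using (Lab; SL)
  open Potential using (flipS; mirL)
  open import Data.List using (List; []; _∷_; _++_)
  open import Data.List.Relation.Unary.All using (All; []; _∷_)
  open import Data.List.Relation.Unary.Any using (here; there)
  open import Data.List.Membership.Propositional using (_∈_; _∉_)
  open import Data.List.Membership.Propositional.Properties using (∈-++⁺ˡ; ∈-++⁺ʳ; ∈-++⁻; ∈-∃++)
  open import Data.Bool using (true; false)
  open import Data.Product using (_×_; _,_; proj₁)
  open import Data.Sum using (_⊎_; inj₁; inj₂)
  open import Data.Empty using (⊥-elim)
  open import Data.Unit using (⊤; tt)
  open import Relation.Binary.PropositionalEquality

  -- A signed label list is nested (relative to already seen positive labels) when every negative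
  -- crossing is preceded by a positive crossing of the same pair of strands and followed by none.
  -- This is the shape of the labels of u ū v v̄, and reversing preserves it.
  NestedFrom : List Lab → List SL → Set
  NestedFrom seen [] = ⊤
  NestedFrom seen ((true , L) ∷ z) = NestedFrom (L ∷ seen) z
  NestedFrom seen ((false , L) ∷ z) = L ∈ seen × (true , L) ∉ z × NestedFrom seen z

  Nested : List SL → Set
  Nested = NestedFrom []

  seen+ : List Lab → List SL → List Lab
  seen+ seen [] = seen
  seen+ seen ((true , L) ∷ a) = seen+ (L ∷ seen) a
  seen+ seen ((false , L) ∷ a) = seen+ seen a

  _⊑_ : List Lab → List Lab → Set
  s ⊑ s′ = ∀ {L} → L ∈ s → L ∈ s′

  ∷-⊑ : ∀ {s s′} L → s ⊑ s′ → (L ∷ s) ⊑ (L ∷ s′)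
  ∷-⊑ L h (here e) = here e
  ∷-⊑ L h (there m) = there (h m)

  nested-mono : ∀ {s s′} z → s ⊑ s′ → NestedFrom s z → NestedFrom s′ z
  nested-mono [] h n = tt
  nested-mono ((true , L) ∷ z) h n = nested-mono z (∷-⊑ L h) n
  nested-mono ((false , L) ∷ z) h (m , fresh , n) = h m , fresh , nested-mono z h n

  seen+-init : ∀ {s L} a → L ∈ s → L ∈ seen+ s a
  seen+-init [] m = m
  seen+-init ((true , L′) ∷ a) m = seen+-init a (there m)
  seen+-init ((false , L′) ∷ a) m = seen+-init a m

  seen+-pos : ∀ {s L} a → (true , L) ∈ a → L ∈ seen+ s a
  seen+-pos ((true , L′) ∷ a) (here refl) = seen+-init a (here refl)
  seen+-pos ((true , L′) ∷ a) (there m) = seen+-pos a m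
  seen+-pos ((false , L′) ∷ a) (there m) = seen+-pos a m

  nested-matched : ∀ {s P rest} pre → NestedFrom s (pre ++ (false , P) ∷ rest) → P ∈ s ⊎ (true , P) ∈ pre
  nested-matched [] (m , _ , _) = inj₁ m
  nested-matched ((true , L) ∷ pre) n with nested-matched pre n
  ... | inj₁ (here refl) = inj₂ (here refl)
  ... | inj₁ (there m) = inj₁ m
  ... | inj₂ m = inj₂ (there m)
  nested-matched ((false , L) ∷ pre) (_ , _ , n) with nested-matched pre n
  ... | inj₁ m = inj₁ m
  ... | inj₂ m = inj₂ (there m)

  matched-in-prefix : ∀ {P rest} pre → Nested (pre ++ (false , P) ∷ rest) → (true , P) ∈ pre
  matched-in-prefix pre n with nested-matched pre n
  ... | inj₁ ()
  ... | inj₂ m = m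

  nested-neg-matched : ∀ {z L} → Nested z → (false , L) ∈ z → (true , L) ∈ z
  nested-neg-matched n m with ∈-∃++ m
  ... | pre , rest , refl = ∈-++⁺ˡ (matched-in-prefix pre n)

  nested-++ : ∀ s a b → NestedFrom s a → NestedFrom (seen+ s a) b → (∀ {L} → (false , L) ∈ a → (true , L) ∉ b) →
    NestedFrom s (a ++ b)
  nested-++ s [] b _ nb _ = nb
  nested-++ s ((true , L) ∷ a) b na nb sep = nested-++ (L ∷ s) a b na nb (λ m → sep (there m))
  nested-++ s ((false , L) ∷ a) b (m , fresh , na) nb sep =
    m , fresh′ , nested-++ s a b na nb (λ m′ → sep (there m′))
    where
    fresh′ : (true , L) ∉ a ++ b
    fresh′ m′ with ∈-++⁻ a m′
    ... | inj₁ ma = fresh ma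
    ... | inj₂ mb = sep (here refl) mb

  nested-replace : ∀ s pre X X′ S → (∀ {L} → (true , L) ∈ X′ ++ S → (false , L) ∈ pre → (true , L) ∈ X ++ S) →
    (NestedFrom (seen+ s pre) (X ++ S) → NestedFrom (seen+ s pre) (X′ ++ S)) →
    NestedFrom s (pre ++ X ++ S) → NestedFrom s (pre ++ X′ ++ S)
  nested-replace s [] X X′ S _ local n = local n
  nested-replace s ((true , L) ∷ pre) X X′ S c local n = nested-replace (L ∷ s) pre X X′ S (λ m m′ → c m (there m′)) local n
  nested-replace s ((false , L) ∷ pre) X X′ S c local (m , fresh , n) =
    m , fresh′ , nested-replace s pre X X′ S (λ m′ m″ → c m′ (there m″)) local n
    where
    fresh′ : (true , L) ∉ pre ++ X′ ++ S
    fresh′ m′ with ∈-++⁻ pre m′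
    ... | inj₁ mp = fresh (∈-++⁺ˡ mp)
    ... | inj₂ mx = fresh (∈-++⁺ʳ pre (c mx (here refl)))

  nested-II : ∀ pre P Q S → Nested (pre ++ (false , P) ∷ (true , Q) ∷ S) → Nested (pre ++ (true , Q) ∷ (false , P) ∷ S)
  nested-II pre P Q S = nested-replace [] pre ((false , P) ∷ (true , Q) ∷ []) ((true , Q) ∷ (false , P) ∷ []) S moved local
    where
    moved : ∀ {L} → (true , L) ∈ (true , Q) ∷ (false , P) ∷ S → _ → (true , L) ∈ (false , P) ∷ (true , Q) ∷ S
    moved (here e) _ = there (here e)
    moved (there (there m)) _ = there (there m)
    local : ∀ {s} → NestedFrom s ((false , P) ∷ (true , Q) ∷ S) → NestedFrom s ((true , Q) ∷ (false , P) ∷ S)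
    local (m , fresh , n) = there m , (λ m′ → fresh (there m′)) , n

  nested-I : ∀ pre P Q R S → (true , R) ∉ pre ++ (false , P) ∷ (true , Q) ∷ S →
    Nested (pre ++ (false , P) ∷ (true , Q) ∷ S) →
    Nested (pre ++ (true , R) ∷ (true , Q) ∷ (false , P) ∷ (false , R) ∷ S)
  nested-I pre P Q R S R-new n =
    nested-replace [] pre ((false , P) ∷ (true , Q) ∷ []) ((true , R) ∷ (true , Q) ∷ (false , P) ∷ (false , R) ∷ []) S
      moved local n
    where
    moved : ∀ {L} → (true , L) ∈ (true , R) ∷ (true , Q) ∷ (false , P) ∷ (false , R) ∷ S → (false , L) ∈ pre →
      (true , L) ∈ (false , P) ∷ (true , Q) ∷ S
    moved (here refl) m = ⊥-elim (R-new (nested-neg-matched n (∈-++⁺ˡ m)))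
    moved (there (here e)) _ = there (here e)
    moved (there (there (there (there m)))) _ = there (there m)
    local : ∀ {s} → NestedFrom s ((false , P) ∷ (true , Q) ∷ S) →
      NestedFrom s ((true , R) ∷ (true , Q) ∷ (false , P) ∷ (false , R) ∷ S)
    local {s} (m , fresh , n′) =
      there (there m) , (λ { (there m′) → fresh (there m′) }) ,
      there (here refl) , (λ m′ → R-new (∈-++⁺ʳ pre (there (there m′)))) ,
      nested-mono S (λ { (here e) → here e ; (there m′) → there (there m′) }) n′

  AllPos : List SL → Set
  AllPos = All (λ a → proj₁ a ≡ true)

  mirL-flip : ∀ {x} A → x ∈ mirL A → flipS x ∈ A
  mirL-flip (a ∷ A) m with ∈-++⁻ (mirL A) m
  ... | inj₁ m′ = there (mirL-flip A m′)
  mirL-flip ((true , l) ∷ A) m | inj₂ (here refl) = here refl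
  mirL-flip ((false , l) ∷ A) m | inj₂ (here refl) = here refl

  neg∉pos : ∀ {A L} → AllPos A → (false , L) ∉ A
  neg∉pos (() ∷ _) (here refl)
  neg∉pos (_ ∷ ap) (there m) = neg∉pos ap m

  pos∉mirL : ∀ {L} A → AllPos A → (true , L) ∉ mirL A
  pos∉mirL A ap m = neg∉pos ap (mirL-flip A m)

  nested-positive : ∀ s A → AllPos A → NestedFrom s A
  nested-positive s [] [] = tt
  nested-positive s ((true , L) ∷ A) (refl ∷ ap) = nested-positive (L ∷ s) A ap

  nested-mirror : ∀ s A → AllPos A → (∀ {L} → (true , L) ∈ A → L ∈ s) → NestedFrom s (mirL A)
  nested-mirror s [] [] _ = tt
  nested-mirror s ((true , l) ∷ A) (refl ∷ ap) seen =
    nested-++ s (mirL A) ((false , l) ∷ []) (nested-mirror s A ap (λ m → seen (there m)))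
      (seen+-init (mirL A) (seen (here refl)) , (λ ()) , tt) (λ { _ (here ()) ; _ (there ()) })

  nested-mirrored : ∀ s A → AllPos A → NestedFrom s (A ++ mirL A)
  nested-mirrored s A ap =
    nested-++ s A (mirL A) (nested-positive s A ap) (nested-mirror (seen+ s A) A ap (seen+-pos A))
      (λ m → ⊥-elim (neg∉pos ap m))

  nested-initial : ∀ A B → AllPos A → AllPos B → (∀ {L} → (true , L) ∈ A → (true , L) ∉ B) →
    Nested ((A ++ mirL A) ++ (B ++ mirL B))
  nested-initial A B apA apB disjoint =
    nested-++ [] (A ++ mirL A) (B ++ mirL B) (nested-mirrored [] A apA) (nested-mirrored _ B apB) separated
    where
    separated : ∀ {L} → (false , L) ∈ A ++ mirL A → (true , L) ∉ B ++ mirL B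
    separated m m′ with ∈-++⁻ A m | ∈-++⁻ B m′
    ... | inj₁ mA | _ = neg∉pos apA mA
    ... | inj₂ _ | inj₂ mM = pos∉mirL B apB mM
    ... | inj₂ mM | inj₁ mB = disjoint (mirL-flip A mM) mB

-- The orientation weight attached to a list of labels Lx without repetition (the crossings of
-- the final word u v′): f A B = 1 when A , B form an item and A precedes B in Lx, else 0.
module Orientation (Lx : List Labels.Lab) (Lx-unique : Unique Lx) where

  open Labels using (Lab; SL; firstIdx; posL; posL-∈; posL-++; before-index)
  open import Data.List using ([]; _∷_; _++_)
  open Blocks
  open Potential using (module Weighted)
  open import Data.Nat using (_<_; _<?_; z≤n; s≤s)
  import Data.Nat.Properties as ℕ
  open import Data.Integer using (ℤ; _+_; _-_; _≤_; 0ℤ; 1ℤ; +≤+; -≤+)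
  open import Data.Integer.Properties using (+-identityʳ; +-identityˡ; +-monoʳ-≤)
  open import Data.List.Relation.Unary.Any using (here; there)
  open import Data.List.Relation.Binary.Sublist.Propositional using (_⊆_; ⊆-refl; ⊆-trans; from∈)
  open import Data.List.Relation.Binary.Sublist.Propositional.Properties using (++⁺; ++⁺ˡ)
  open import Data.List.Membership.Propositional using (_∈_)
  open import Data.Bool using (true; false)
  open import Data.Product using (_×_; _,_; proj₁; proj₂)
  open import Data.Sum using (_⊎_; inj₁; inj₂)
  open import Data.Empty using (⊥-elim)
  open import Relation.Nullary using (¬_; yes; no)
  open import Relation.Binary.PropositionalEquality

  f : Lab → Lab → ℤ
  f A B with item? A B | firstIdx A Lx <? firstIdx B Lx
  ... | yes _ | yes _ = 1ℤ
  ... | yes _ | no _ = 0ℤ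
  ... | no _ | _ = 0ℤ

  open Weighted f public

  f-non-item : ∀ {A B} → ¬ Item A B → f A B ≡ 0ℤ
  f-non-item {A} {B} n with item? A B | firstIdx A Lx <? firstIdx B Lx
  ... | yes i | _ = ⊥-elim (n i)
  ... | no _ | _ = refl

  f-diag : ∀ A → f A A ≡ 0ℤ
  f-diag A with item? A A | firstIdx A Lx <? firstIdx A Lx
  ... | yes _ | yes l = ⊥-elim (ℕ.<-irrefl refl l)
  ... | yes _ | no _ = refl
  ... | no _ | _ = refl

  f-zero-one : ∀ A B → (f A B ≡ 0ℤ) ⊎ (f A B ≡ 1ℤ)
  f-zero-one A B with item? A B | firstIdx A Lx <? firstIdx B Lx
  ... | yes _ | yes _ = inj₂ refl
  ... | yes _ | no _ = inj₁ refl
  ... | no _ | _ = inj₁ refl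

  f-item : ∀ {A B} → Item A B → A ∷ B ∷ [] ⊆ Lx → (f A B ≡ 1ℤ) × (f B A ≡ 0ℤ)
  f-item {A} {B} i o = forward , backward
    where
    A<B : firstIdx A Lx < firstIdx B Lx
    A<B = before-index Lx-unique o
    forward : f A B ≡ 1ℤ
    forward with item? A B | firstIdx A Lx <? firstIdx B Lx
    ... | yes _ | yes _ = refl
    ... | yes _ | no n = ⊥-elim (n A<B)
    ... | no n | _ = ⊥-elim (n i)
    backward : f B A ≡ 0ℤ
    backward with item? B A | firstIdx B Lx <? firstIdx A Lx
    ... | yes _ | yes B<A = ⊥-elim (ℕ.<-asym A<B B<A)
    ... | yes _ | no _ = refl
    ... | no _ | _ = refl

  ordered : ∀ {A B : Lab} {L} (xs ys : List Lab) → A ∈ xs → B ∈ ys → xs ++ ys ⊆ L → A ∷ B ∷ [] ⊆ L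
  ordered xs ys mA mB sub = ⊆-trans (++⁺ (from∈ mA) (from∈ mB)) sub

  potential-II : ∀ pre P Q S → Item P Q → (true , P) ∈ pre → posL (pre ++ (true , Q) ∷ (false , P) ∷ S) ⊆ Lx →
    Λ (pre ++ (true , Q) ∷ (false , P) ∷ S) ≡ Λ (pre ++ (false , P) ∷ (true , Q) ∷ S) + 1ℤ
  potential-II pre P Q S item P∈pre sub = begin
    Λ (pre ++ X′ ++ S)               ≡⟨ replace pre X X′ S (λ a → row-II a P Q) (λ c → col-II c P Q) ⟩
    Λ (pre ++ X ++ S) + (Λ X′ - Λ X)  ≡⟨ cong (Λ (pre ++ X ++ S) +_) (trans (Δ-II P Q) (cong₂ _-_ PQ QP)) ⟩
    Λ (pre ++ X ++ S) + 1ℤ            ∎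
    where
    open ≡-Reasoning
    X : List SL
    X = (false , P) ∷ (true , Q) ∷ []
    X′ : List SL
    X′ = (true , Q) ∷ (false , P) ∷ []
    PQ-order : P ∷ Q ∷ [] ⊆ Lx
    PQ-order = ordered (posL pre) _ (posL-∈ P∈pre) (here refl) (subst (_⊆ Lx) (posL-++ pre _) sub)
    PQ : f P Q ≡ 1ℤ
    PQ = proj₁ (f-item item PQ-order)
    QP : f Q P ≡ 0ℤ
    QP = proj₂ (f-item item PQ-order)

  private
    one-change : ∀ {rq qr pr rp pq qp rr x₁ y₁ x₂ y₂ x₃ y₃ : ℤ} →
      rq ≡ x₁ → qr ≡ y₁ → pr ≡ x₂ → rp ≡ y₂ → pq ≡ x₃ → qp ≡ y₃ → rr ≡ 0ℤ →
      (x₁ - y₁) + (x₂ - y₂) + (x₃ - y₃) ≡ 1ℤ → (rq - qr) + (pr - rp) + (pq - qp) - rr ≡ 1ℤ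
    one-change refl refl refl refl refl refl refl h = trans (+-identityʳ _) h

  ΔI-one : ∀ {P Q R} → OneItem P Q R → P ∷ Q ∷ [] ⊆ Lx → P ∷ R ∷ [] ⊆ Lx → R ∷ Q ∷ [] ⊆ Lx →
    (f R Q - f Q R) + (f P R - f R P) + (f P Q - f Q P) - f R R ≡ 1ℤ
  ΔI-one {P} {Q} {R} (itemAB iPQ nPR nQR) oPQ _ _ =
    one-change (f-non-item (non-item-sym nQR)) (f-non-item nQR) (f-non-item nPR) (f-non-item (non-item-sym nPR))
      (proj₁ (f-item iPQ oPQ)) (proj₂ (f-item iPQ oPQ)) (f-diag R) refl
  ΔI-one {P} {Q} {R} (itemAC nPQ iPR nQR) _ oPR _ =
    one-change (f-non-item (non-item-sym nQR)) (f-non-item nQR) (proj₁ (f-item iPR oPR)) (proj₂ (f-item iPR oPR))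
      (f-non-item nPQ) (f-non-item (non-item-sym nPQ)) (f-diag R) refl
  ΔI-one {P} {Q} {R} (itemBC nPQ nPR iQR) _ _ oRQ =
    one-change (proj₁ (f-item (item-sym iQR) oRQ)) (proj₂ (f-item (item-sym iQR) oRQ)) (f-non-item nPR)
      (f-non-item (non-item-sym nPR)) (f-non-item nPQ) (f-non-item (non-item-sym nPQ)) (f-diag R) refl

  potential-I : ∀ pre P Q R S → OneItem P Q R → (true , P) ∈ pre →
    posL (pre ++ (true , R) ∷ (true , Q) ∷ (false , P) ∷ (false , R) ∷ S) ⊆ Lx →
    Λ (pre ++ (true , R) ∷ (true , Q) ∷ (false , P) ∷ (false , R) ∷ S) ≡ Λ (pre ++ (false , P) ∷ (true , Q) ∷ S) + 1ℤ
  potential-I pre P Q R S one P∈pre sub = begin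
    Λ (pre ++ X′ ++ S)               ≡⟨ replace pre X X′ S (λ a → row-I a P Q R) (λ c → col-I c P Q R) ⟩
    Λ (pre ++ X ++ S) + (Λ X′ - Λ X)  ≡⟨ cong (Λ (pre ++ X ++ S) +_) (trans (Δ-I P Q R) (ΔI-one one oPQ oPR oRQ)) ⟩
    Λ (pre ++ X ++ S) + 1ℤ            ∎
    where
    open ≡-Reasoning
    X : List SL
    X = (false , P) ∷ (true , Q) ∷ []
    X′ : List SL
    X′ = (true , R) ∷ (true , Q) ∷ (false , P) ∷ (false , R) ∷ []
    sub′ : posL pre ++ R ∷ Q ∷ posL S ⊆ Lx
    sub′ = subst (_⊆ Lx) (posL-++ pre _) sub
    oPQ : P ∷ Q ∷ [] ⊆ Lx
    oPQ = ordered (posL pre) _ (posL-∈ P∈pre) (there (here refl)) sub′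
    oPR : P ∷ R ∷ [] ⊆ Lx
    oPR = ordered (posL pre) _ (posL-∈ P∈pre) (here refl) sub′
    oRQ : R ∷ Q ∷ [] ⊆ Lx
    oRQ = ⊆-trans (++⁺ˡ (posL pre) (ordered (R ∷ []) (Q ∷ posL S) (here refl) (here refl) ⊆-refl)) sub′

  private
    zero-one-diff : ∀ {a b} → (a ≡ 0ℤ) ⊎ (a ≡ 1ℤ) → (b ≡ 0ℤ) ⊎ (b ≡ 1ℤ) → a - b ≤ 1ℤ
    zero-one-diff (inj₁ refl) (inj₁ refl) = +≤+ z≤n
    zero-one-diff (inj₁ refl) (inj₂ refl) = -≤+
    zero-one-diff (inj₂ refl) (inj₁ refl) = +≤+ (s≤s z≤n)
    zero-one-diff (inj₂ refl) (inj₂ refl) = +≤+ z≤n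

    diff≤1 : ∀ A B → f A B - f B A ≤ 1ℤ
    diff≤1 A B = zero-one-diff (f-zero-one A B) (f-zero-one B A)

    diff0 : ∀ {A B} → ¬ Item A B → f A B - f B A ≡ 0ℤ
    diff0 n = cong₂ _-_ (f-non-item n) (f-non-item (non-item-sym n))

    only-first : ∀ {a b c} → b ≡ 0ℤ → c ≡ 0ℤ → a ≤ 1ℤ → a + b + c ≤ 1ℤ
    only-first {a} refl refl h = subst (_≤ 1ℤ) (sym (trans (+-identityʳ _) (+-identityʳ a))) h

    only-second : ∀ {a b c} → a ≡ 0ℤ → c ≡ 0ℤ → b ≤ 1ℤ → a + b + c ≤ 1ℤ
    only-second {b = b} refl refl h = subst (_≤ 1ℤ) (sym (trans (+-identityʳ _) (+-identityˡ b))) h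

    only-third : ∀ {a b c} → a ≡ 0ℤ → b ≡ 0ℤ → c ≤ 1ℤ → a + b + c ≤ 1ℤ
    only-third {c = c} refl refl h = subst (_≤ 1ℤ) (sym (+-identityˡ c)) h

  ΔB1≤1 : ∀ {α β γ} → OneItem α β γ → (f α β - f β α) + (f α γ - f γ α) + (f β γ - f γ β) ≤ 1ℤ
  ΔB1≤1 {α} {β} {γ} (itemAB _ nαγ nβγ) = only-first (diff0 nαγ) (diff0 nβγ) (diff≤1 α β)
  ΔB1≤1 {α} {β} {γ} (itemAC nαβ _ nβγ) = only-second (diff0 nαβ) (diff0 nβγ) (diff≤1 α γ)
  ΔB1≤1 {α} {β} {γ} (itemBC nαβ nαγ _) = only-third (diff0 nαβ) (diff0 nαγ) (diff≤1 β γ)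

  braid-I-potential : ∀ pre α β γ T → OneItem α β γ →
    Λ (pre ++ (true , α) ∷ (true , β) ∷ (true , γ) ∷ T) ≤ Λ (pre ++ (true , γ) ∷ (true , β) ∷ (true , α) ∷ T) + 1ℤ
  braid-I-potential pre α β γ T one = subst₂ _≤_
    (sym (replace⁻ pre B B′ T (λ a → row-B1 a α β γ) (λ c → col-B1 c α β γ))) refl
    (+-monoʳ-≤ (Λ (pre ++ B′ ++ T)) (subst (_≤ 1ℤ) (sym (Δ-B1 α β γ)) (ΔB1≤1 one)))
    where
    B : List SL
    B = (true , α) ∷ (true , β) ∷ (true , γ) ∷ []
    B′ : List SL
    B′ = (true , γ) ∷ (true , β) ∷ (true , α) ∷ []

  braid-II-potential : ∀ pre P Q T →
    Λ (pre ++ (true , P) ∷ (true , Q) ∷ T) ≤ Λ (pre ++ (true , Q) ∷ (true , P) ∷ T) + 1ℤ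
  braid-II-potential pre P Q T = subst₂ _≤_
    (sym (replace⁻ pre B B′ T (λ a → row-B2 a P Q) (λ c → col-B2 c P Q))) refl
    (+-monoʳ-≤ (Λ (pre ++ B′ ++ T)) (subst (_≤ 1ℤ) (sym (Δ-B2 P Q)) (diff≤1 P Q)))
    where
    B : List SL
    B = (true , P) ∷ (true , Q) ∷ []
    B′ : List SL
    B′ = (true , Q) ∷ (true , P) ∷ []

module LocalSteps where

  open Reversing using (negs; result; Allowed)
  open Transpositions
  open Strands
  open Labels
  open Blocks
  open Potential using (mirL)
  open Nesting using (AllPos)
  open import Data.Nat using (suc; _<_)
  open import Data.List using (List; []; _∷_; _++_)
  open import Data.List.Relation.Unary.All using ([]; _∷_)
  open import Data.Bool using (true; false)
  open import Data.Product using (_×_; _,_)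
  open import Data.Empty using (⊥-elim)
  open import Data.Unit using (tt)
  open import Relation.Binary.PropositionalEquality

  retrace : ∀ s u k → after (after s (emb u)) (negs u) k ≡ s k
  retrace s [] k = refl
  retrace s (a ∷ u) k =
    trans (cong (λ f → f k) (after-++ (after (act s a) (emb u)) (negs u) (neg a ∷ [])))
          (trans (retrace (act s a) u (transp a k)) (cong s (transp-involutive a k)))

  labs-mirror : ∀ s u → labs (after s (emb u)) (negs u) ≡ mirL (labs s (emb u))
  labs-mirror s [] = refl
  labs-mirror s (a ∷ u) =
    trans (labs-++ (after (act s a) (emb u)) (negs u) (neg a ∷ []))
          (cong₂ _++_ (labs-mirror (act s a) u)
             (cong (λ q → (false , q) ∷ []) (trans (cong₂ pair (retrace (act s a) u a) (retrace (act s a) u (suc a)))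
                (trans (cong₂ pair (cong s (transp-i a)) (cong s (transp-si a))) (pair-sym _ _)))))

  good-mirror : ∀ s u → Good s (emb u) → Good (after s (emb u)) (negs u)
  good-mirror s [] g = tt
  good-mirror s (a ∷ u) (lt , g) =
    good-++ (after (act s a) (emb u)) (negs u) (neg a ∷ []) (good-mirror (act s a) u g)
      (subst₂ _<_ (sym (trans (retrace (act s a) u (suc a)) (cong s (transp-si a))))
                  (sym (trans (retrace (act s a) u a) (cong s (transp-i a)))) lt , tt)

  labs-positive : ∀ s u → AllPos (labs s (emb u))
  labs-positive s [] = []
  labs-positive s (a ∷ u) = refl ∷ labs-positive (act s a) u

  posL-negs : ∀ s y → posL (labs s (negs y)) ≡ []
  posL-negs s [] = refl
  posL-negs s (a ∷ y) = trans (cong posL (labs-++ s (negs y) (neg a ∷ [])))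
    (trans (posL-++ (labs s (negs y)) _) (cong (_++ []) (posL-negs s y)))

  posL-mirL : ∀ A → AllPos A → posL (mirL A) ≡ []
  posL-mirL [] _ = refl
  posL-mirL ((true , l) ∷ A) (refl ∷ h) = trans (posL-++ (mirL A) _) (cong (_++ []) (posL-mirL A h))

  labs-block : ∀ s a B B′ r → (∀ k → after (after s a) B k ≡ after (after s a) B′ k) →
    (labs s (a ++ B ++ r) ≡ labs s a ++ labs (after s a) B ++ labs (after (after s a) B) r) ×
    (labs s (a ++ B′ ++ r) ≡ labs s a ++ labs (after s a) B′ ++ labs (after (after s a) B) r)
  labs-block s a B B′ r same =
    trans (labs-++ s a (B ++ r)) (cong (labs s a ++_) (labs-++ (after s a) B r)) ,
    trans (labs-++ s a (B′ ++ r)) (cong (labs s a ++_) (trans (labs-++ (after s a) B′ r)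
      (cong (labs (after s a) B′ ++_) (labs-cong (λ k → sym (same k)) r))))

  good-block : ∀ s a B B′ r → (∀ k → after (after s a) B k ≡ after (after s a) B′ k) →
    (Good (after s a) B → Good (after s a) B′) → Good s (a ++ B ++ r) → Good s (a ++ B′ ++ r)
  good-block s a B B′ r same local g =
    good-++ s a (B′ ++ r) (good-++ˡ s a (B ++ r) g)
      (good-++ (after s a) B′ r (local (good-++ˡ (after s a) B r g′)) (good-cong same r (good-++ʳ (after s a) B r g′)))
    where
    g′ : Good (after s a) (B ++ r)
    g′ = good-++ʳ s a (B ++ r) g

  data StepShape : List SL → List SL → Set where
    shapeII : ∀ P Q → Item P Q → StepShape ((false , P) ∷ (true , Q) ∷ []) ((true , Q) ∷ (false , P) ∷ [])
    shapeI : ∀ P Q R → OneItem P Q R →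
      StepShape ((false , P) ∷ (true , Q) ∷ []) ((true , R) ∷ (true , Q) ∷ (false , P) ∷ (false , R) ∷ [])

  record LocalStep (σ : State) (B B′ : SWord) : Set where
    field
      shape : StepShape (labs σ B) (labs σ B′)
      sameState : ∀ k → after σ B k ≡ after σ B′ k
      keepsGood : Good σ B → Good σ B′

  localStep : ∀ {σ} t i j → Inj σ → Allowed t i j → t ≢ typeIII → LocalStep σ (neg i ∷ pos j ∷ []) (result t i j)
  localStep typeI i j inj adj _ = record
    { shape = subst₂ StepShape (sym labelsBefore) (sym labelsAfter) (shapeI P Q R oneItem)
    ; sameState = sameState ; keepsGood = keepsGood }
    where open ReversalI (reversalI inj adj)
  localStep typeII i j inj far _ = record
    { shape = subst₂ StepShape (sym labelsBefore) (sym labelsAfter) (shapeII P Q isItem)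
    ; sameState = sameState ; keepsGood = keepsGood }
    where open ReversalII (reversalII inj far)
  localStep typeIII i j inj _ nt = ⊥-elim (nt refl)

module LowerBound where

  open Reversing using (negs; negs-++; bar-emb; NoIII; redex; redexOf; result)
  open Strands
  open Labels
  open Blocks using (braidI; braidII; module BraidI; module BraidII)
  open Potential using (mirL)
  open Nesting
  open LocalSteps
  open import Data.Nat using (ℕ; suc; _≤_)
  open import Data.Integer using (ℤ; +_; 0ℤ; 1ℤ) renaming (_+_ to _+ℤ_; _≤_ to _≤ℤ_)
  import Data.Integer.Properties as ℤ
  open import Data.List using (List; []; _∷_; _++_; length)
  open import Data.List.Properties using (++-assoc; ++-identityʳ; map-++)
  open import Data.List.Relation.Unary.All using (All; []; _∷_)
  open import Data.List.Relation.Unary.Any using (here; there)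
  open import Data.List.Relation.Unary.Unique.Propositional using (Unique; _∷_)
  open import Data.List.Relation.Unary.Unique.Propositional.Properties using (Unique[x∷xs]⇒x∉xs)
  open import Data.List.Relation.Binary.Sublist.Propositional using (_⊆_; ⊆-refl; ⊆-trans; _∷ʳ_)
  open import Data.List.Relation.Binary.Sublist.Propositional.Properties using (++⁺; ++⁺ˡ)
  open import Data.List.Membership.Propositional using (_∉_)
  open import Data.List.Membership.Propositional.Properties using (∈-++⁻)
  open import Data.Bool using (true; false)
  open import Data.Product using (_×_; _,_; proj₁; proj₂)
  open import Data.Sum using (inj₁; inj₂)
  open import Relation.Binary.PropositionalEquality

  data Replacement (z z′ : List SL) : Set where
    replacement : ∀ pre X X′ T → StepShape X X′ → z ≡ pre ++ X ++ T → z′ ≡ pre ++ X′ ++ T → Replacement z z′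

  positives-grow : ∀ {z z′} → Replacement z z′ → posL z ⊆ posL z′
  positives-grow (replacement pre _ _ T (shapeII P Q _) refl refl)
    rewrite posL-++ pre ((false , P) ∷ (true , Q) ∷ T) | posL-++ pre ((true , Q) ∷ (false , P) ∷ T) = ⊆-refl
  positives-grow (replacement pre _ _ T (shapeI P Q R _) refl refl)
    rewrite posL-++ pre ((false , P) ∷ (true , Q) ∷ T) | posL-++ pre ((true , R) ∷ (true , Q) ∷ (false , P) ∷ (false , R) ∷ T) =
    ++⁺ (⊆-refl {x = posL pre}) (R ∷ʳ ⊆-refl)

  module Raise (Lx : List Lab) (Lx-unique : Unique Lx) where
    open Orientation Lx Lx-unique

    raise : ∀ {z z′} → Replacement z z′ → Nested z → posL z′ ⊆ Lx → (Λ z′ ≡ Λ z +ℤ 1ℤ) × Nested z′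
    raise (replacement pre _ _ T (shapeII P Q item) refl refl) n sub =
      potential-II pre P Q T item (matched-in-prefix pre n) sub , nested-II pre P Q T n
    raise (replacement pre _ _ T (shapeI P Q R one) refl refl) n sub =
      potential-I pre P Q R T one (matched-in-prefix pre n) sub , nested-I pre P Q R T R-new n
      where
      positives : Unique (posL pre ++ R ∷ Q ∷ posL T)
      positives = unique-⊆ (subst (_⊆ Lx) (posL-++ pre _) sub) Lx-unique
      R∉rest : R ∉ Q ∷ posL T
      R∉rest = Unique[x∷xs]⇒x∉xs (unique-⊆ (++⁺ˡ (posL pre) ⊆-refl) positives)
      R-new : (true , R) ∉ pre ++ (false , P) ∷ (true , Q) ∷ T
      R-new m with ∈-++⁻ pre m
      ... | inj₁ m₁ = unique-disjoint (posL pre) positives (posL-∈ m₁) (here refl)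
      ... | inj₂ (there (here e)) = R∉rest (here (cong proj₂ e))
      ... | inj₂ (there (there m₂)) = R∉rest (there (posL-∈ m₂))

  -- Reversing w inside the word u w v̄: the letters of u and v̄ are not touched, but they fix the
  -- strand labels.  Initially w = ū v, so that u w v̄ = u ū v v̄.
  module Sandwich (u v : List ℕ) where

    sandwich : SWord → SWord
    sandwich w = emb u ++ w ++ negs v

    sandwichLabels : SWord → List SL
    sandwichLabels w = labs idS (sandwich w)

    sandwich-context : ∀ p B s → sandwich (p ++ B ++ s) ≡ (emb u ++ p) ++ B ++ (s ++ negs v)
    sandwich-context p B s = trans (cong (emb u ++_) (trans (++-assoc p (B ++ s) _) (cong (p ++_) (++-assoc B s _))))
                                   (sym (++-assoc (emb u) p _))

    step-replacement : ∀ {t w w′} → RevStep t w w′ → t ≢ typeIII →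
      Replacement (sandwichLabels w) (sandwichLabels w′) × (Good idS (sandwich w) → Good idS (sandwich w′))
    step-replacement {t} st nt with redexOf st
    ... | redex p s i j ok refl refl =
      replacement (labs idS a) (labs σ B) (labs σ B′) (labs (after σ B) r) shape
        (trans (cong (labs idS) (sandwich-context p B s)) (proj₁ (labs-block idS a B B′ r sameState)))
        (trans (cong (labs idS) (sandwich-context p B′ s)) (proj₂ (labs-block idS a B B′ r sameState))) ,
      λ g → subst (Good idS) (sym (sandwich-context p B′ s))
              (good-block idS a B B′ r sameState keepsGood (subst (Good idS) (sandwich-context p B s) g))
      where
      a : SWord
      a = emb u ++ p
      σ : State
      σ = after idS a
      r : SWord
      r = s ++ negs v
      B : SWord
      B = neg i ∷ pos j ∷ []
      B′ : SWord
      B′ = result t i j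
      open LocalStep (localStep t i j (after-inj a idS-inj) ok nt)

    seq-positives : ∀ {ts w z} → RevSeq ts w z → NoIII ts → posL (sandwichLabels w) ⊆ posL (sandwichLabels z)
    seq-positives (rdone _) _ = ⊆-refl
    seq-positives (rstep st sq) (n ∷ ns) = ⊆-trans (positives-grow (proj₁ (step-replacement st n))) (seq-positives sq ns)

    seq-good : ∀ {ts w z} → RevSeq ts w z → NoIII ts → Good idS (sandwich w) → Good idS (sandwich z)
    seq-good (rdone _) _ g = g
    seq-good (rstep st sq) (n ∷ ns) g = seq-good sq ns (proj₂ (step-replacement st n) g)

    seq-potential : ∀ zf (uniq : Unique (posL (sandwichLabels zf))) → let open Orientation (posL (sandwichLabels zf)) uniq in
      ∀ {ts w} → RevSeq ts w zf → NoIII ts → Nested (sandwichLabels w) → Λ (sandwichLabels zf) ≡ Λ (sandwichLabels w) +ℤ + length ts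
    seq-potential zf uniq = go
      where
      open Orientation (posL (sandwichLabels zf)) uniq
      open Raise (posL (sandwichLabels zf)) uniq
      go : ∀ {ts w} → RevSeq ts w zf → NoIII ts → Nested (sandwichLabels w) → Λ (sandwichLabels zf) ≡ Λ (sandwichLabels w) +ℤ + length ts
      go (rdone _) _ _ = sym (ℤ.+-identityʳ _)
      go {_ ∷ ts} {w} (rstep st sq) (n ∷ ns) nest with raise (proj₁ (step-replacement st n)) nest (seq-positives sq ns)
      ... | up , nest′ = trans (go sq ns nest′) (trans (cong (_+ℤ + length ts) up) (ℤ.+-assoc (Λ (sandwichLabels w)) 1ℤ (+ length ts)))

    Lu : List SL
    Lu = labs idS (emb u)
    Lv : List SL
    Lv = labs idS (emb v)

    -- Reading u ū returns to the identity state, so the labels of u ū v v̄ are those of u ū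
    -- followed by those of v v̄; they are good, nested and have potential 0.
    initial-word : sandwich (negs u ++ emb v) ≡ (emb u ++ negs u) ++ (emb v ++ negs v)
    initial-word = trans (cong (emb u ++_) (++-assoc (negs u) (emb v) (negs v))) (sym (++-assoc (emb u) (negs u) _))

    returns : ∀ k → after idS (emb u ++ negs u) k ≡ idS k
    returns k = trans (cong (λ f → f k) (after-++ idS (emb u) (negs u))) (retrace idS u k)

    initial-labels : sandwichLabels (negs u ++ emb v) ≡ (Lu ++ mirL Lu) ++ (Lv ++ mirL Lv)
    initial-labels = trans (cong (labs idS) initial-word)
      (trans (labs-++ idS (emb u ++ negs u) (emb v ++ negs v))
        (cong₂ _++_ (trans (labs-++ idS (emb u) (negs u)) (cong (Lu ++_) (labs-mirror idS u)))
                    (trans (labs-cong returns (emb v ++ negs v)) (trans (labs-++ idS (emb v) (negs v)) (cong (Lv ++_) (labs-mirror idS v))))))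

    initial-positives : posL (sandwichLabels (negs u ++ emb v)) ≡ posL Lu ++ posL Lv
    initial-positives = trans (cong posL initial-labels)
      (trans (posL-++ (Lu ++ mirL Lu) _) (cong₂ _++_ (mirrored-positives Lu (labs-positive idS u)) (mirrored-positives Lv (labs-positive idS v))))
      where
      mirrored-positives : ∀ A → AllPos A → posL (A ++ mirL A) ≡ posL A
      mirrored-positives A ap = trans (posL-++ A (mirL A)) (trans (cong (posL A ++_) (posL-mirL A ap)) (++-identityʳ _))

    initial-good : Good idS (emb u) → Good idS (emb v) → Good idS (sandwich (negs u ++ emb v))
    initial-good gu gv = subst (Good idS) (sym initial-word)
      (good-++ idS (emb u ++ negs u) (emb v ++ negs v) (good-++ idS (emb u) (negs u) gu (good-mirror idS u gu))
        (good-cong (λ k → sym (returns k)) (emb v ++ negs v) (good-++ idS (emb v) (negs v) gv (good-mirror idS v gv))))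

    initial-nested : Unique (posL (sandwichLabels (negs u ++ emb v))) → Nested (sandwichLabels (negs u ++ emb v))
    initial-nested uniq = subst Nested (sym initial-labels)
      (nested-initial Lu Lv (labs-positive idS u) (labs-positive idS v)
        (λ mu mv → unique-disjoint (posL Lu) (subst Unique initial-positives uniq) (posL-∈ mu) (posL-∈ mv)))

    initial-potential : ∀ Lx (uniq : Unique Lx) → Orientation.Λ Lx uniq (sandwichLabels (negs u ++ emb v)) ≡ 0ℤ
    initial-potential Lx uniq = trans (cong Λ initial-labels) (Diagonal.Λ-mirrored₂ f-diag Lu Lv)
      where open Orientation Lx uniq

    final-word : ∀ v′ u′ → sandwich (emb v′ ++ negs u′) ≡ emb (u ++ v′) ++ negs (v ++ u′)
    final-word v′ u′ = trans (cong (emb u ++_) (++-assoc (emb v′) (negs u′) (negs v)))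
      (trans (sym (++-assoc (emb u) (emb v′) _)) (cong₂ _++_ (sym (map-++ pos u v′)) (sym (negs-++ v u′))))

    final-positives : ∀ v′ u′ → posL (sandwichLabels (emb v′ ++ negs u′)) ≡ posL (labs idS (emb (u ++ v′)))
    final-positives v′ u′ = trans (cong (λ q → posL (labs idS q)) (final-word v′ u′))
      (trans (cong posL (labs-++ idS (emb (u ++ v′)) (negs (v ++ u′))))
        (trans (posL-++ (labs idS (emb (u ++ v′))) _) (trans (cong (_ ++_) (posL-negs _ (v ++ u′))) (++-identityʳ _))))

    -- The final word is good (seq-good), so its positive crossings, those of x, are pairwise distinct.
    final-unique : ∀ v′ u′ → Good idS (sandwich (emb v′ ++ negs u′)) → Unique (posL (sandwichLabels (emb v′ ++ negs u′)))
    final-unique v′ u′ g = subst Unique (sym (final-positives v′ u′))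
      (labels-unique idS (u ++ v′) (good-++ˡ idS (emb (u ++ v′)) _ (subst (Good idS) (final-word v′ u′) g)) idS-inj)

  module Relative (Lx : List Lab) (Lx-unique : Unique Lx) (y : List ℕ) where
    open Orientation Lx Lx-unique

    Φ : List ℕ → ℤ
    Φ x = Λ (labs idS (emb x ++ negs y))

    emb-context : ∀ p B s → emb (p ++ B ++ s) ++ negs y ≡ emb p ++ emb B ++ (emb s ++ negs y)
    emb-context p B s = trans (cong (_++ negs y) (trans (map-++ pos p (B ++ s)) (cong (emb p ++_) (map-++ pos B s))))
                              (trans (++-assoc (emb p) _ _) (cong (emb p ++_) (++-assoc (emb B) _ _)))

    braid-step : ∀ {x x′} → BraidStep x x′ → Φ x ≤ℤ Φ x′ +ℤ 1ℤ
    braid-step (rel-I p s i j adj) =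
      subst₂ (λ a b → Λ a ≤ℤ Λ b +ℤ 1ℤ) (sym before) (sym after′) (braid-I-potential (labs idS (emb p)) α β γ T oneItem)
      where
      σ : State
      σ = after idS (emb p)
      B : List ℕ
      B = i ∷ j ∷ i ∷ []
      B′ : List ℕ
      B′ = j ∷ i ∷ j ∷ []
      open BraidI (braidI {σ} (after-inj (emb p) idS-inj) adj)
      T : List SL
      T = labs (after σ (emb B)) (emb s ++ negs y)
      before : labs idS (emb (p ++ B ++ s) ++ negs y) ≡ labs idS (emb p) ++ (true , α) ∷ (true , β) ∷ (true , γ) ∷ T
      before = trans (cong (labs idS) (emb-context p B s)) (trans (proj₁ (labs-block idS (emb p) (emb B) (emb B′) (emb s ++ negs y) sameState)) (cong (λ q → labs idS (emb p) ++ q ++ T) labelsBefore))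
      after′ : labs idS (emb (p ++ B′ ++ s) ++ negs y) ≡ labs idS (emb p) ++ (true , γ) ∷ (true , β) ∷ (true , α) ∷ T
      after′ = trans (cong (labs idS) (emb-context p B′ s)) (trans (proj₂ (labs-block idS (emb p) (emb B) (emb B′) (emb s ++ negs y) sameState)) (cong (λ q → labs idS (emb p) ++ q ++ T) labelsAfter))
    braid-step (rel-II p s i j far) =
      subst₂ (λ a b → Λ a ≤ℤ Λ b +ℤ 1ℤ) (sym before) (sym after′) (braid-II-potential (labs idS (emb p)) P Q T)
      where
      σ : State
      σ = after idS (emb p)
      B : List ℕ
      B = i ∷ j ∷ []
      B′ : List ℕ
      B′ = j ∷ i ∷ []
      open BraidII (braidII {σ} far)
      T : List SL
      T = labs (after σ (emb B)) (emb s ++ negs y)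
      before : labs idS (emb (p ++ B ++ s) ++ negs y) ≡ labs idS (emb p) ++ (true , P) ∷ (true , Q) ∷ T
      before = trans (cong (labs idS) (emb-context p B s)) (trans (proj₁ (labs-block idS (emb p) (emb B) (emb B′) (emb s ++ negs y) sameState)) (cong (λ q → labs idS (emb p) ++ q ++ T) labelsBefore))
      after′ : labs idS (emb (p ++ B′ ++ s) ++ negs y) ≡ labs idS (emb p) ++ (true , Q) ∷ (true , P) ∷ T
      after′ = trans (cong (labs idS) (emb-context p B′ s)) (trans (proj₂ (labs-block idS (emb p) (emb B) (emb B′) (emb s ++ negs y) sameState)) (cong (λ q → labs idS (emb p) ++ q ++ T) labelsAfter))

    braid-path : ∀ {k x z} → BraidPath k x z → Φ x ≤ℤ Φ z +ℤ + k
    braid-path (done x) = ℤ.≤-reflexive (sym (ℤ.+-identityʳ _))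
    braid-path {suc k} {x} {z} (step st b) =
      ℤ.≤-trans (braid-step st) (ℤ.≤-trans (ℤ.+-monoˡ-≤ 1ℤ (braid-path b))
        (ℤ.≤-reflexive (trans (ℤ.+-assoc (Φ z) (+ k) 1ℤ) (cong (Φ z +ℤ_) (ℤ.+-comm (+ k) 1ℤ)))))

    Φ-self : Φ y ≡ 0ℤ
    Φ-self = trans (cong Λ (trans (labs-++ idS (emb y) (negs y)) (cong (labs idS (emb y) ++_) (labs-mirror idS y))))
                   (Diagonal.Λ-mirrored f-diag (labs idS (emb y)))

  -- Orient the potential by the crossings of the final word u v′ ū′ v̄.  The
  -- initial word u ū v v̄ has potential 0 and each of the N reversing steps adds one, so the final
  -- word, which is x ȳ for x = u v′ and y = v u′, has potential N.  A braid path of length k from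
  -- x to y changes the potential of x ȳ by at most k, down to that of y ȳ, which is 0.
  reversingLowerBound : ∀ u v u′ v′ ts → Good idS (emb u) → Good idS (emb v) →
    RevSeq ts (negs u ++ emb v) (emb v′ ++ negs u′) → NoIII ts →
    ∀ k → BraidPath k (u ++ v′) (v ++ u′) → length ts ≤ k
  reversingLowerBound u v u′ v′ ts gu gv sq ns k path =
    ℤ.drop‿+≤+ (subst₂ _≤ℤ_ Φx≡N Φy+k≡k (braid-path path))
    where
    open Sandwich u v
    zf : SWord
    zf = emb v′ ++ negs u′
    uniq : Unique (posL (sandwichLabels zf))
    uniq = final-unique v′ u′ (seq-good sq ns (initial-good gu gv))
    open Relative (posL (sandwichLabels zf)) uniq (v ++ u′)
    open Orientation (posL (sandwichLabels zf)) uniq using (Λ)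
    potential-N : Λ (sandwichLabels zf) ≡ + length ts
    potential-N = trans (seq-potential zf uniq sq ns (initial-nested (unique-⊆ (seq-positives sq ns) uniq)))
                        (trans (cong (_+ℤ + length ts) (initial-potential _ uniq)) (ℤ.+-identityˡ _))
    Φx≡N : Φ (u ++ v′) ≡ + length ts
    Φx≡N = trans (cong (λ q → Λ (labs idS q)) (sym (final-word v′ u′))) potential-N
    Φy+k≡k : Φ (v ++ u′) +ℤ + k ≡ + k
    Φy+k≡k = trans (cong (_+ℤ + k) Φ-self) (ℤ.+-identityˡ _)

open Reversing using (negs; bar-emb; upperBound)
open Strands using (reduced-good)
open LowerBound using (reversingLowerBound)

proposition2p7 : (n : ℕ) (u v u' v' : List ℕ) (ts : List RevType) →
    Reduced n u → Reduced n v →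
    RevSeq ts (bar (emb u) ++ emb v) (emb v' ++ bar (emb u')) →
    All (λ t → t ≢ typeIII) ts →
    Dist (u ++ v') (v ++ u') (length ts)
proposition2p7 n u v u' v' ts reduced-u reduced-v reversing admissible =
  upperBound (length ts) u v v' u' ts refl reversing′ admissible ,
  reversingLowerBound u v u' v' ts (reduced-good n u reduced-u) (reduced-good n v reduced-v) reversing′ admissible
  where
  reversing′ : RevSeq ts (negs u ++ emb v) (emb v' ++ negs u')
  reversing′ = subst₂ (RevSeq ts) (cong (_++ emb v) (bar-emb u)) (cong (emb v' ++_) (bar-emb u')) reversing
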